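{- The set of real numbers $r$ such that $r$ is a root of $\mathrm{NRel}(G;p)$ for some finite simple graph $G$ is unbounded.
   Context: For a finite simple undirected graph $G$ with $n$ nodes, a connected set of $G$ is a nonempty subset of nodes inducing a connected subgraph. Let $c_k$ be the number of connected sets of $G$ of order $k$. The node reliability polynomial of $G$ is $\mathrm{NRel}(G;p)=\sum_{k=1}^n c_k p^k(1-p)^{n-k}$, regarded as a polynomial in $p$; its roots are the node reliability roots of $G$. -}

module Defs where

open import Data.Bool using (Bool; true; false; _∧_; _∨_; if_then_else_; T)
open import Data.Nat as ℕ using (ℕ; zero; suc)
open import Data.Fin using (Fin; zero; suc; _≟_)
open import Data.List using (List; []; _∷_; _++_; map; filter; length; foldr; concatMap)
open import Data.Bool.ListAction using (any; all)
open import Data.List using () renaming (sum to sumℕ)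
open import Data.Fin using () 
open import Data.List.Base using ()
open import Data.Vec.Functional using ()
open import Data.Integer using (+_)
open import Data.Rational using (ℚ; 0ℚ; 1ℚ; _+_; _*_; _-_; ∣_∣; _≤_; _<_; _/_)
open import Relation.Binary.PropositionalEquality using (_≡_)
open import Relation.Nullary.Decidable using (⌊_⌋)
open import Data.Product using (Σ; ∃; ∃-syntax; _×_)
open import Data.List using (upTo)

allFin : (n : ℕ) → List (Fin n)
allFin zero = []
allFin (suc n) = zero ∷ map suc (allFin n)

record Graph : Set where
  field
    n       : ℕ
    nonempty : 1 ℕ.≤ n
    adj     : Fin n → Fin n → Bool
    sym     : ∀ u v → adj u v ≡ adj v u
    irrefl  : ∀ u → adj u u ≡ false

Subset : ℕ → Set
Subset n = Fin n → Bool

allSubsets : (n : ℕ) → List (Subset n)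
allSubsets zero = (λ ()) ∷ []
allSubsets (suc n) = concatMap (λ S → ext false S ∷ ext true S ∷ []) (allSubsets n)
  where
  ext : Bool → Subset n → Subset (suc n)
  ext b S zero = b
  ext b S (suc i) = S i

size : {n : ℕ} → Subset n → ℕ
size {n} S = length (filter (λ i → T? (S i)) (allFin n))
  where
  open import Relation.Nullary using (Dec; yes; no)
  T? : (b : Bool) → Dec (T b)
  T? true = yes _
  T? false = no (λ ())

module _ (G : Graph) where
  open Graph G

  step : Subset n → Subset n → Subset n
  step S R v = R v ∨ (S v ∧ any (λ u → R u ∧ adj u v) (allFin n))

  iter : ℕ → (Subset n → Subset n) → Subset n → Subset n
  iter zero f x = x
  iter (suc k) f x = f (iter k f x)

  -- nodes reachable from u by a walk inside S (walks of length ≤ n suffice)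
  reach : Subset n → Fin n → Subset n
  reach S u = iter n (step S) (λ v → ⌊ v ≟ u ⌋)

  isConnectedSet : Subset n → Bool
  isConnectedSet S with filter (λ i → Data.Bool._≟_ (S i) true) (allFin n)
    where import Data.Bool
  ... | [] = false
  ... | u ∷ _ = all (λ v → if S v then reach S u v else true) (allFin n)

  c : ℕ → ℕ
  c k = length (filter (λ S → Data.Bool._≟_ (isConnectedSet S ∧ ⌊ size S ℕ.≟ k ⌋) true) (allSubsets n))
    where import Data.Bool

  pow : ℚ → ℕ → ℚ
  pow q zero = 1ℚ
  pow q (suc k) = q * pow q k

  NRel : ℚ → ℚ
  NRel p = foldr (λ k acc → ((+ (c k) / 1) * pow p k * pow (1ℚ - p) (n ℕ.∸ k)) + acc)
                 0ℚ (map suc (upTo n))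

-- Real numbers (Bishop's regular Cauchy sequences of rationals)

record ℝ : Set where
  field
    seq : ℕ → ℚ
    reg : ∀ m k → ∣ seq m - seq k ∣ ≤ (+ 1 / suc m) + (+ 1 / suc k)

-- NRel(G; r) = 0 for a real r: since NRel(G;-) is a polynomial (continuous),
-- its value at r is the limit of its values at the approximants of r.
IsNodeReliabilityRoot : Graph → ℝ → Set
IsNodeReliabilityRoot G r =
  ∀ (k : ℕ) → ∃[ N ] ∀ (m : ℕ) → N ℕ.≤ m →
    ∣ NRel G (ℝ.seq r m) ∣ ≤ (+ 1 / suc k)

-- B < |r| for a natural number B (Bishop's positivity of |r| - B)
_<∣_∣ : ℕ → ℝ → Set
B <∣ r ∣ = ∃[ m ] ((+ B / 1) + (+ 1 / suc m)) < ∣ ℝ.seq r m ∣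

module Submission where

-- The witnesses are paths. The connected sets of the path Pₙ are its intervals, so with q = 1 − p
-- a geometric-series computation gives (q − p)² NRel(Pₙ; p) = p (pⁿ⁺¹ − (n + 1) p qⁿ + n qⁿ⁺¹).
-- For even n and p = m + 1 the sign of NRel is that of (m + 1)ⁿ⁺¹ − (n + 1)(m + 1)mⁿ − n mⁿ⁺¹: positive when
-- n + 1 = m², since (1 + 1/m)^(m²) ≥ 2^m, and negative at m = 2(n + 1), by Bernoulli's inequality.
-- NRel is Lipschitz on bounded intervals, so bisection between these two integers converges to a real root,
-- and that root exceeds m + 1.

open import Defs
open import Data.Nat using (ℕ)
open import Data.Product using (Σ; ∃; ∃-syntax; _×_)

module RationalFacts where

  open import Algebra.Bundles using (Ring)
  open import Data.Nat as ℕ using (ℕ; zero; suc)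
  import Data.Nat.Properties as ℕ
  open import Data.Integer as ℤ using (+_; 1ℤ)
  open import Data.Rational
  open import Data.Rational.Properties
  import Data.Rational.Unnormalised as ℚᵘ
  import Data.Rational.Unnormalised.Properties as ℚᵘ
  import Data.Integer.Solver as ZS
  import Data.Rational.Solver as Solver
  open import Data.Product using (_,_)
  open import Relation.Binary.PropositionalEquality
  open import Algebra.Properties.Semiring.Mult (Ring.semiring +-*-ring)
    using (×-homo-+; ×1-homo-*) renaming (_×_ to _·_)
  open import Algebra.Definitions.RawSemiring +-*-rawSemiring using (_^_)
  open import Algebra.Properties.Semiring.Exp (Ring.semiring +-*-ring) using (^-assocʳ)

  module QS = Solver.+-*-Solver

  fromℕ : ℕ → ℚ
  fromℕ n = n · 1ℚ

  fromℕ-+ : ∀ m n → fromℕ (m ℕ.+ n) ≡ fromℕ m + fromℕ n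
  fromℕ-+ = ×-homo-+ 1ℚ

  fromℕ-* : ∀ m n → fromℕ (m ℕ.* n) ≡ fromℕ m * fromℕ n
  fromℕ-* = ×1-homo-*

  fromℕ-^ : ∀ a k → fromℕ (a ℕ.^ k) ≡ fromℕ a ^ k
  fromℕ-^ a zero    = refl
  fromℕ-^ a (suc k) = trans (fromℕ-* a (a ℕ.^ k)) (cong (fromℕ a *_) (fromℕ-^ a k))

  ^-even : ∀ x {N} K → N ≡ 2 ℕ.* K → (- x) ^ N ≡ x ^ N
  ^-even x K refl = begin
    (- x) ^ (2 ℕ.* K)   ≡⟨ ^-assocʳ (- x) 2 K ⟨
    ((- x) ^ 2) ^ K     ≡⟨ cong (_^ K) (QS.solve 1 (λ x → (QS.:- x) QS.:* ((QS.:- x) QS.:* QS.con 1ℚ) QS.:= x QS.:* (x QS.:* QS.con 1ℚ)) refl x) ⟩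
    (x ^ 2) ^ K         ≡⟨ ^-assocʳ x 2 K ⟩
    x ^ (2 ℕ.* K)       ∎
    where open ≡-Reasoning

  toℚᵘ-fromℕ : ∀ n → toℚᵘ (fromℕ n) ℚᵘ.≃ ℚᵘ.mkℚᵘ (+ n) 0
  toℚᵘ-fromℕ zero = ℚᵘ.≃-refl
  toℚᵘ-fromℕ (suc n) = ℚᵘ.≃-trans (toℚᵘ-homo-+ 1ℚ (fromℕ n))
    (ℚᵘ.≃-trans (ℚᵘ.+-congʳ (toℚᵘ 1ℚ) (toℚᵘ-fromℕ n)) (ℚᵘ.*≡* (solve 1 (λ x → (con 1ℤ :* con 1ℤ :+ x :* con 1ℤ) :* con 1ℤ := (con 1ℤ :+ x) :* (con 1ℤ :* con 1ℤ)) refl (+ n))))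
    where open ZS.+-*-Solver

  fromℕ≡/1 : ∀ n → fromℕ n ≡ + n / 1
  fromℕ≡/1 n = trans (sym (fromℚᵘ-toℚᵘ (fromℕ n))) (fromℚᵘ-cong (toℚᵘ-fromℕ n))

  1/suc*suc : ∀ m → (+ 1 / suc m) * fromℕ (suc m) ≡ 1ℚ
  1/suc*suc m = toℚᵘ-injective (ℚᵘ.≃-trans (toℚᵘ-homo-* (+ 1 / suc m) (fromℕ (suc m)))
    (ℚᵘ.≃-trans (ℚᵘ.*-cong (toℚᵘ-fromℚᵘ (ℚᵘ.mkℚᵘ (+ 1) m)) (toℚᵘ-fromℕ (suc m)))
      (ℚᵘ.*≡* (solve 1 (λ x → (con 1ℤ :* (con 1ℤ :+ x)) :* con 1ℤ := con 1ℤ :* ((con 1ℤ :+ x) :* con 1ℤ)) refl (+ m)))))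
    where open ZS.+-*-Solver

  0<1 : 0ℚ < 1ℚ
  0<1 = *<* (ℤ.+<+ (ℕ.s≤s ℕ.z≤n))

  0≤1 : 0ℚ ≤ 1ℚ
  0≤1 = <⇒≤ 0<1

  x≤x+y : ∀ x {y} → 0ℚ ≤ y → x ≤ x + y
  x≤x+y x {y} 0≤y = subst (_≤ x + y) (+-identityʳ x) (+-monoʳ-≤ x 0≤y)

  0≤fromℕ : ∀ n → 0ℚ ≤ fromℕ n
  0≤fromℕ zero = ≤-refl
  0≤fromℕ (suc n) = +-mono-≤ 0≤1 (0≤fromℕ n)

  fromℕ-mono-≤ : ∀ {m n} → m ℕ.≤ n → fromℕ m ≤ fromℕ n
  fromℕ-mono-≤ {m} m≤n with ℕ.m≤n⇒∃[o]m+o≡n m≤n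
  ... | o , refl = subst (fromℕ m ≤_) (sym (fromℕ-+ m o)) (x≤x+y (fromℕ m) (0≤fromℕ o))

  fromℕ-mono-< : ∀ {m n} → m ℕ.< n → fromℕ m < fromℕ n
  fromℕ-mono-< {m} {suc n} (ℕ.s≤s m≤n) =
    ≤-<-trans (fromℕ-mono-≤ m≤n) (subst (_< fromℕ (suc n)) (+-identityˡ (fromℕ n)) (+-monoˡ-< (fromℕ n) 0<1))

  0≤1/suc : ∀ k → 0ℚ ≤ + 1 / suc k
  0≤1/suc k = nonNegative⁻¹ (+ 1 / suc k) {{normalize-nonNeg 1 (suc k)}}

  p≤q⇒0≤q-p : ∀ {p q} → p ≤ q → 0ℚ ≤ q - p
  p≤q⇒0≤q-p {p} {q} p≤q = subst (_≤ q - p) (+-inverseʳ p) (+-monoˡ-≤ (- p) p≤q)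

  0≤q-p⇒p≤q : ∀ {p q} → 0ℚ ≤ q - p → p ≤ q
  0≤q-p⇒p≤q {p} {q} h = subst (p ≤_) (QS.solve 2 (λ p q → p QS.:+ (q QS.:- p) QS.:= q) refl p q) (x≤x+y p h)

  ∣p-q∣≡∣q-p∣ : ∀ p q → ∣ p - q ∣ ≡ ∣ q - p ∣
  ∣p-q∣≡∣q-p∣ p q = trans (cong ∣_∣ (QS.solve 2 (λ p q → p QS.:- q QS.:= QS.:- (q QS.:- p)) refl p q)) (∣-p∣≡∣p∣ (q - p))

  *-mono-≤-nonNeg : ∀ {a b c d} → 0ℚ ≤ a → a ≤ b → 0ℚ ≤ c → c ≤ d → a * c ≤ b * d
  *-mono-≤-nonNeg {a} {b} {c} {d} 0≤a a≤b 0≤c c≤d =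
    ≤-trans (*-monoʳ-≤-nonNeg c {{nonNegative 0≤c}} a≤b) (*-monoˡ-≤-nonNeg b {{nonNegative (≤-trans 0≤a a≤b)}} c≤d)

  0≤* : ∀ {a b} → 0ℚ ≤ a → 0ℚ ≤ b → 0ℚ ≤ a * b
  0≤* {a} {b} 0≤a 0≤b = subst (_≤ a * b) (*-zeroˡ b) (*-monoʳ-≤-nonNeg b {{nonNegative 0≤b}} 0≤a)

  ∣*∣-mono-≤ : ∀ {a b A B} → ∣ a ∣ ≤ A → ∣ b ∣ ≤ B → ∣ a * b ∣ ≤ A * B
  ∣*∣-mono-≤ {a} {b} ∣a∣≤A ∣b∣≤B =
    subst (_≤ _) (sym (∣p*q∣≡∣p∣*∣q∣ a b)) (*-mono-≤-nonNeg (0≤∣p∣ a) ∣a∣≤A (0≤∣p∣ b) ∣b∣≤B)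

  half : ℚ
  half = + 1 / 2

  0≤half : 0ℚ ≤ half
  0≤half = 0≤1/suc 1

  0≤half^ : ∀ j → 0ℚ ≤ half ^ j
  0≤half^ zero = 0≤1
  0≤half^ (suc j) = 0≤* 0≤half (0≤half^ j)

  2^j*half^j : ∀ j → fromℕ (2 ℕ.^ j) * half ^ j ≡ 1ℚ
  2^j*half^j zero = refl
  2^j*half^j (suc j) = begin
    fromℕ (2 ℕ.* 2 ℕ.^ j) * (half * half ^ j)     ≡⟨ cong (_* (half * half ^ j)) (fromℕ-* 2 (2 ℕ.^ j)) ⟩
    fromℕ 2 * fromℕ (2 ℕ.^ j) * (half * half ^ j) ≡⟨ QS.solve 2 (λ x y → (QS.con (fromℕ 2) QS.:* x) QS.:* (QS.con half QS.:* y) QS.:= x QS.:* y) refl (fromℕ (2 ℕ.^ j)) (half ^ j) ⟩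
    fromℕ (2 ℕ.^ j) * half ^ j                    ≡⟨ 2^j*half^j j ⟩
    1ℚ                                             ∎
    where open ≡-Reasoning

  *half^j≤1/suc : ∀ A k j → A ℕ.* suc k ℕ.≤ 2 ℕ.^ j → fromℕ A * half ^ j ≤ + 1 / suc k
  *half^j≤1/suc A k j A[k+1]≤2^j = begin
    fromℕ A * half ^ j                                            ≡⟨ *-identityʳ _ ⟨
    fromℕ A * half ^ j * 1ℚ                                       ≡⟨ cong (fromℕ A * half ^ j *_) (trans (*-comm (fromℕ (suc k)) (+ 1 / suc k)) (1/suc*suc k)) ⟨
    fromℕ A * half ^ j * (fromℕ (suc k) * (+ 1 / suc k))          ≡⟨ QS.solve 4 (λ a h i r → a QS.:* h QS.:* (i QS.:* r) QS.:= a QS.:* i QS.:* h QS.:* r) refl (fromℕ A) (half ^ j) (fromℕ (suc k)) (+ 1 / suc k) ⟩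
    fromℕ A * fromℕ (suc k) * half ^ j * (+ 1 / suc k)            ≡⟨ cong (λ z → z * half ^ j * (+ 1 / suc k)) (fromℕ-* A (suc k)) ⟨
    fromℕ (A ℕ.* suc k) * half ^ j * (+ 1 / suc k)                ≤⟨ *-monoʳ-≤-nonNeg (+ 1 / suc k) {{normalize-nonNeg 1 (suc k)}}
                                                                        (*-monoʳ-≤-nonNeg (half ^ j) {{nonNegative (0≤half^ j)}} (fromℕ-mono-≤ A[k+1]≤2^j)) ⟩
    fromℕ (2 ℕ.^ j) * half ^ j * (+ 1 / suc k)                    ≡⟨ cong (_* (+ 1 / suc k)) (2^j*half^j j) ⟩
    1ℚ * (+ 1 / suc k)                                             ≡⟨ *-identityˡ _ ⟩
    + 1 / suc k                                                    ∎
    where open ≤-Reasoning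

module Lipschitz where

  open import Data.Nat as ℕ using (ℕ; zero; suc)
  open import Data.Integer using (+_)
  open import Data.List using ([]; _∷_; foldr; map; upTo)
  open import Data.Rational
  open import Data.Rational.Properties
  open import Data.Product using (_,_)
  open import Relation.Binary.PropositionalEquality
  open RationalFacts

  _∈[_,_] : ℚ → ℚ → ℚ → Set
  x ∈[ a , b ] = a ≤ x × x ≤ b

  module OnInterval (lo hi : ℚ) (H : ℕ) (0≤lo : 0ℚ ≤ lo) (hi≤H : hi ≤ fromℕ H) where

    record BoundedLipschitz (f : ℚ → ℚ) : Set where
      field
        bound constant : ℕ
        bounded   : ∀ {x} → x ∈[ lo , hi ] → ∣ f x ∣ ≤ fromℕ bound
        lipschitz : ∀ {x y} → x ∈[ lo , hi ] → y ∈[ lo , hi ] →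
                    ∣ f x - f y ∣ ≤ fromℕ constant * ∣ x - y ∣

    open BoundedLipschitz

    const-BL : ∀ c K → ∣ c ∣ ≤ fromℕ K → BoundedLipschitz (λ _ → c)
    const-BL c K ∣c∣≤K = record
      { bound = K ; constant = 0 ; bounded = λ _ → ∣c∣≤K
      ; lipschitz = λ {x} {y} _ _ → ≤-reflexive (trans (cong ∣_∣ (+-inverseʳ c)) (sym (*-zeroˡ ∣ x - y ∣))) }

    id-BL : BoundedLipschitz (λ x → x)
    id-BL = record
      { bound = H ; constant = 1
      ; bounded = λ (lo≤x , x≤hi) → ≤-trans (≤-reflexive (0≤p⇒∣p∣≡p (≤-trans 0≤lo lo≤x))) (≤-trans x≤hi hi≤H)
      ; lipschitz = λ {x} {y} _ _ → ≤-reflexive (sym (*-identityˡ ∣ x - y ∣)) }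

    +-BL : ∀ {f g} → BoundedLipschitz f → BoundedLipschitz g → BoundedLipschitz (λ x → f x + g x)
    +-BL {f} {g} F G = record
      { bound = bound F ℕ.+ bound G ; constant = constant F ℕ.+ constant G
      ; bounded = λ {x} x∈ → begin
          ∣ f x + g x ∣                     ≤⟨ ∣p+q∣≤∣p∣+∣q∣ (f x) (g x) ⟩
          ∣ f x ∣ + ∣ g x ∣                 ≤⟨ +-mono-≤ (bounded F x∈) (bounded G x∈) ⟩
          fromℕ (bound F) + fromℕ (bound G) ≡⟨ fromℕ-+ (bound F) (bound G) ⟨
          fromℕ (bound F ℕ.+ bound G)       ∎
      ; lipschitz = λ {x} {y} x∈ y∈ → begin
          ∣ (f x + g x) - (f y + g y) ∣     ≡⟨ cong ∣_∣ (QS.solve 4 (λ a b c d → (a QS.:+ c) QS.:- (b QS.:+ d) QS.:= (a QS.:- b) QS.:+ (c QS.:- d)) refl (f x) (f y) (g x) (g y)) ⟩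
          ∣ (f x - f y) + (g x - g y) ∣     ≤⟨ ∣p+q∣≤∣p∣+∣q∣ (f x - f y) (g x - g y) ⟩
          ∣ f x - f y ∣ + ∣ g x - g y ∣     ≤⟨ +-mono-≤ (lipschitz F x∈ y∈) (lipschitz G x∈ y∈) ⟩
          fromℕ (constant F) * ∣ x - y ∣ + fromℕ (constant G) * ∣ x - y ∣
            ≡⟨ *-distribʳ-+ ∣ x - y ∣ (fromℕ (constant F)) (fromℕ (constant G)) ⟨
          (fromℕ (constant F) + fromℕ (constant G)) * ∣ x - y ∣
            ≡⟨ cong (_* ∣ x - y ∣) (fromℕ-+ (constant F) (constant G)) ⟨
          fromℕ (constant F ℕ.+ constant G) * ∣ x - y ∣ ∎ }
      where open ≤-Reasoning

    neg-BL : ∀ {f} → BoundedLipschitz f → BoundedLipschitz (λ x → - f x)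
    neg-BL {f} F = record
      { bound = bound F ; constant = constant F
      ; bounded = λ {x} x∈ → subst (_≤ _) (sym (∣-p∣≡∣p∣ (f x))) (bounded F x∈)
      ; lipschitz = λ {x} {y} x∈ y∈ → subst (_≤ _) (sym (trans (cong ∣_∣ (neg-distrib x y)) (∣-p∣≡∣p∣ (f x - f y)))) (lipschitz F x∈ y∈) }
      where
      neg-distrib : ∀ x y → (- f x) - (- f y) ≡ - (f x - f y)
      neg-distrib x y = QS.solve 2 (λ a b → (QS.:- a) QS.:- (QS.:- b) QS.:= QS.:- (a QS.:- b)) refl (f x) (f y)

    *-BL : ∀ {f g} → BoundedLipschitz f → BoundedLipschitz g → BoundedLipschitz (λ x → f x * g x)
    *-BL {f} {g} F G = record
      { bound = bound F ℕ.* bound G ; constant = bound F ℕ.* constant G ℕ.+ bound G ℕ.* constant F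
      ; bounded = λ {x} x∈ → subst (_ ≤_) (sym (fromℕ-* (bound F) (bound G))) (∣*∣-mono-≤ (bounded F x∈) (bounded G x∈))
      ; lipschitz = λ {x} {y} x∈ y∈ → begin
          ∣ f x * g x - f y * g y ∣
            ≡⟨ cong ∣_∣ (QS.solve 4 (λ a b c d → a QS.:* c QS.:- b QS.:* d QS.:= a QS.:* (c QS.:- d) QS.:+ d QS.:* (a QS.:- b)) refl (f x) (f y) (g x) (g y)) ⟩
          ∣ f x * (g x - g y) + g y * (f x - f y) ∣
            ≤⟨ ∣p+q∣≤∣p∣+∣q∣ (f x * (g x - g y)) (g y * (f x - f y)) ⟩
          ∣ f x * (g x - g y) ∣ + ∣ g y * (f x - f y) ∣
            ≤⟨ +-mono-≤ (∣*∣-mono-≤ (bounded F x∈) (lipschitz G x∈ y∈)) (∣*∣-mono-≤ (bounded G y∈) (lipschitz F x∈ y∈)) ⟩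
          bF * (cG * ∣ x - y ∣) + bG * (cF * ∣ x - y ∣)
            ≡⟨ QS.solve 5 (λ a b c e z → a QS.:* (b QS.:* z) QS.:+ c QS.:* (e QS.:* z) QS.:= (a QS.:* b QS.:+ c QS.:* e) QS.:* z) refl bF cG bG cF ∣ x - y ∣ ⟩
          (bF * cG + bG * cF) * ∣ x - y ∣
            ≡⟨ cong (_* ∣ x - y ∣) (sym (trans (fromℕ-+ (bound F ℕ.* constant G) _) (cong₂ _+_ (fromℕ-* (bound F) (constant G)) (fromℕ-* (bound G) (constant F))))) ⟩
          fromℕ (bound F ℕ.* constant G ℕ.+ bound G ℕ.* constant F) * ∣ x - y ∣ ∎ }
      where
      open ≤-Reasoning
      bF bG cF cG : ℚ
      bF = fromℕ (bound F)
      bG = fromℕ (bound G)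
      cF = fromℕ (constant F)
      cG = fromℕ (constant G)

    pow-BL : ∀ G {f} → BoundedLipschitz f → ∀ k → BoundedLipschitz (λ x → pow G (f x) k)
    pow-BL G F zero = const-BL 1ℚ 1 ≤-refl
    pow-BL G F (suc k) = *-BL F (pow-BL G F k)

    NRel-BL : ∀ G → BoundedLipschitz (NRel G)
    NRel-BL G = sum-BL (map suc (upTo n))
      where
      open Graph G using (n)
      coefficient-BL : ∀ k → BoundedLipschitz (λ _ → + (c G k) / 1)
      coefficient-BL k = const-BL (+ c G k / 1) (c G k)
        (≤-reflexive (trans (cong ∣_∣ (sym (fromℕ≡/1 (c G k)))) (0≤p⇒∣p∣≡p (0≤fromℕ (c G k)))))
      sum-BL : ∀ ks → BoundedLipschitz (λ p → foldr (λ k acc → ((+ (c G k) / 1) * pow G p k * pow G (1ℚ - p) (n ℕ.∸ k)) + acc) 0ℚ ks)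
      sum-BL [] = const-BL 0ℚ 0 ≤-refl
      sum-BL (k ∷ ks) = +-BL (*-BL (*-BL (coefficient-BL k) (pow-BL G id-BL k))
        (pow-BL G (+-BL (const-BL 1ℚ 1 ≤-refl) (neg-BL id-BL)) (n ℕ.∸ k))) (sum-BL ks)

module IntermediateValue where

  open import Data.Nat as ℕ using (ℕ; zero; suc)
  import Data.Nat.Properties as ℕ
  open import Data.Integer using (+_)
  open import Data.Rational
  open import Data.Rational.Properties
  open import Data.Product using (_,_; proj₁; proj₂)
  open import Data.Sum using (inj₁; inj₂)
  open import Relation.Nullary using (yes; no)
  open import Relation.Binary.PropositionalEquality
  open import Algebra.Definitions.RawSemiring +-*-rawSemiring using (_^_)
  open RationalFacts
  open Lipschitz using (_∈[_,_])

  n<2^n : ∀ n → n ℕ.< 2 ℕ.^ n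
  n<2^n zero = ℕ.s≤s ℕ.z≤n
  n<2^n (suc n) = ℕ.+-mono-≤-< (ℕ.m^n>0 2 n) (subst (n ℕ.<_) (sym (ℕ.+-identityʳ (2 ℕ.^ n))) (n<2^n n))

  module Bisection (f : ℚ → ℚ) (lo : ℚ) (W L : ℕ)
    (lipschitz : ∀ {x y} → x ∈[ lo , lo + fromℕ W ] → y ∈[ lo , lo + fromℕ W ] →
                 ∣ f x - f y ∣ ≤ fromℕ L * ∣ x - y ∣)
    (0≤f[lo] : 0ℚ ≤ f lo) (f[hi]≤0 : f (lo + fromℕ W) ≤ 0ℚ) where

    hi : ℚ
    hi = lo + fromℕ W

    mid : ℚ → ℚ → ℚ
    mid a b = (a + b) * half

    bisect : ℚ × ℚ → ℚ × ℚ
    bisect (a , b) with 0ℚ ≤? f (mid a b)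
    ... | yes _ = mid a b , b
    ... | no _  = a , mid a b

    bracket : ℕ → ℚ × ℚ
    bracket zero    = lo , hi
    bracket (suc j) = bisect (bracket j)

    record Bracketing (j : ℕ) (ab : ℚ × ℚ) : Set where
      constructor bracketing
      field
        lo≤a  : lo ≤ proj₁ ab
        b≤hi  : proj₂ ab ≤ hi
        width : proj₂ ab - proj₁ ab ≡ fromℕ W * half ^ j
        0≤f[a] : 0ℚ ≤ f (proj₁ ab)
        f[b]≤0 : f (proj₂ ab) ≤ 0ℚ

    open Bracketing

    module _ {j a b} (B : Bracketing j (a , b)) where

      0≤b-a : 0ℚ ≤ b - a
      0≤b-a = subst (0ℚ ≤_) (sym (width B)) (0≤* (0≤fromℕ W) (0≤half^ j))

      a≤b : a ≤ b
      a≤b = 0≤q-p⇒p≤q 0≤b-a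

      half-width : (b - a) * half ≡ fromℕ W * half ^ (suc j)
      half-width = trans (cong (_* half) (width B))
        (QS.solve 2 (λ w h → w QS.:* h QS.:* QS.con half QS.:= w QS.:* (QS.con half QS.:* h)) refl (fromℕ W) (half ^ j))

      mid-a : mid a b - a ≡ (b - a) * half
      mid-a = QS.solve 2 (λ a b → (a QS.:+ b) QS.:* QS.con half QS.:- a QS.:= (b QS.:- a) QS.:* QS.con half) refl a b

      b-mid : b - mid a b ≡ (b - a) * half
      b-mid = QS.solve 2 (λ a b → b QS.:- (a QS.:+ b) QS.:* QS.con half QS.:= (b QS.:- a) QS.:* QS.con half) refl a b

      a≤mid : a ≤ mid a b
      a≤mid = 0≤q-p⇒p≤q (subst (0ℚ ≤_) (sym mid-a) (0≤* 0≤b-a 0≤half))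

      mid≤b : mid a b ≤ b
      mid≤b = 0≤q-p⇒p≤q (subst (0ℚ ≤_) (sym b-mid) (0≤* 0≤b-a 0≤half))

      bisect-bracketing : Bracketing (suc j) (bisect (a , b))
      bisect-bracketing with 0ℚ ≤? f (mid a b)
      ... | yes 0≤f[mid] = bracketing (≤-trans (lo≤a B) a≤mid) (b≤hi B) (trans b-mid half-width) 0≤f[mid] (f[b]≤0 B)
      ... | no  0≰f[mid] = bracketing (lo≤a B) (≤-trans mid≤b (b≤hi B)) (trans mid-a half-width) (0≤f[a] B) (<⇒≤ (≰⇒> 0≰f[mid]))

      bisect-nested : a ≤ proj₁ (bisect (a , b)) × proj₂ (bisect (a , b)) ≤ b
      bisect-nested with 0ℚ ≤? f (mid a b)
      ... | yes _ = a≤mid , ≤-refl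
      ... | no  _ = ≤-refl , mid≤b

    bracket-bracketing : ∀ j → Bracketing j (bracket j)
    bracket-bracketing zero = bracketing ≤-refl ≤-refl
      (trans (QS.solve 2 (λ l w → (l QS.:+ w) QS.:- l QS.:= w) refl lo (fromℕ W)) (sym (*-identityʳ (fromℕ W))))
      0≤f[lo] f[hi]≤0
    bracket-bracketing (suc j) = bisect-bracketing (bracket-bracketing j)

    left right : ℕ → ℚ
    left j  = proj₁ (bracket j)
    right j = proj₂ (bracket j)

    left-mono : ∀ j i → left j ≤ left (i ℕ.+ j)
    left-mono j zero    = ≤-refl
    left-mono j (suc i) = ≤-trans (left-mono j i) (proj₁ (bisect-nested (bracket-bracketing (i ℕ.+ j))))

    right-anti : ∀ j i → right (i ℕ.+ j) ≤ right j
    right-anti j zero    = ≤-refl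
    right-anti j (suc i) = ≤-trans (proj₂ (bisect-nested (bracket-bracketing (i ℕ.+ j)))) (right-anti j i)

    left-close : ∀ j i → ∣ left (i ℕ.+ j) - left j ∣ ≤ fromℕ W * half ^ j
    left-close j i = subst (_≤ fromℕ W * half ^ j) (sym (0≤p⇒∣p∣≡p (p≤q⇒0≤q-p (left-mono j i))))
      (subst (left (i ℕ.+ j) - left j ≤_) (width (bracket-bracketing j))
        (+-monoˡ-≤ (- left j) (≤-trans (a≤b (bracket-bracketing (i ℕ.+ j))) (right-anti j i))))

    ∣f[left]∣≤ : ∀ j → ∣ f (left j) ∣ ≤ fromℕ L * (fromℕ W * half ^ j)
    ∣f[left]∣≤ j = begin
      ∣ f a ∣             ≡⟨ 0≤p⇒∣p∣≡p (0≤f[a] B) ⟩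
      f a                 ≤⟨ fa≤fa-fb ⟩
      f a - f b           ≡⟨ 0≤p⇒∣p∣≡p (≤-trans (0≤f[a] B) fa≤fa-fb) ⟨
      ∣ f a - f b ∣       ≤⟨ lipschitz (lo≤a B , ≤-trans (a≤b B) (b≤hi B)) (≤-trans (lo≤a B) (a≤b B) , b≤hi B) ⟩
      fromℕ L * ∣ a - b ∣ ≡⟨ cong (fromℕ L *_) (trans (∣p-q∣≡∣q-p∣ a b) (trans (0≤p⇒∣p∣≡p (0≤b-a B)) (width B))) ⟩
      fromℕ L * (fromℕ W * half ^ j) ∎
      where
      open ≤-Reasoning
      a b : ℚ
      a = left j
      b = right j
      B : Bracketing j (a , b)
      B = bracket-bracketing j
      fa≤fa-fb : f a ≤ f a - f b
      fa≤fa-fb = x≤x+y (f a) (neg-antimono-≤ (f[b]≤0 B))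

    W[1+m]≤2^[W+m] : ∀ m → W ℕ.* suc m ℕ.≤ 2 ℕ.^ (W ℕ.+ m)
    W[1+m]≤2^[W+m] m = subst (W ℕ.* suc m ℕ.≤_) (sym (ℕ.^-distribˡ-+-* 2 W m))
      (ℕ.*-mono-≤ (ℕ.<⇒≤ (n<2^n W)) (n<2^n m))

    -- Delaying the index by W absorbs the initial width W into the 1/(m+1) modulus.
    approx : ℕ → ℚ
    approx m = left (W ℕ.+ m)

    approx-close : ∀ m k → m ℕ.≤ k → ∣ approx m - approx k ∣ ≤ + 1 / suc m
    approx-close m k m≤k = begin
      ∣ approx m - approx k ∣                            ≡⟨ ∣p-q∣≡∣q-p∣ (approx m) (approx k) ⟩
      ∣ left (W ℕ.+ k) - approx m ∣                      ≡⟨ cong (λ i → ∣ left i - approx m ∣) W+k≡ ⟨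
      ∣ left (k ℕ.∸ m ℕ.+ (W ℕ.+ m)) - approx m ∣        ≤⟨ left-close (W ℕ.+ m) (k ℕ.∸ m) ⟩
      fromℕ W * half ^ (W ℕ.+ m)                        ≤⟨ *half^j≤1/suc W m (W ℕ.+ m) (W[1+m]≤2^[W+m] m) ⟩
      + 1 / suc m                                        ∎
      where
      open ≤-Reasoning
      W+k≡ : k ℕ.∸ m ℕ.+ (W ℕ.+ m) ≡ W ℕ.+ k
      W+k≡ = trans (ℕ.+-comm (k ℕ.∸ m) (W ℕ.+ m)) (trans (ℕ.+-assoc W m (k ℕ.∸ m)) (cong (W ℕ.+_) (ℕ.m+[n∸m]≡n m≤k)))

    approx-regular : ∀ m k → ∣ approx m - approx k ∣ ≤ (+ 1 / suc m) + (+ 1 / suc k)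
    approx-regular m k with ℕ.≤-total m k
    ... | inj₁ m≤k = ≤-trans (approx-close m k m≤k) (x≤x+y _ (0≤1/suc k))
    ... | inj₂ k≤m = ≤-trans (subst (_≤ + 1 / suc k) (∣p-q∣≡∣q-p∣ (approx k) (approx m)) (approx-close k m k≤m))
                             (subst (+ 1 / suc k ≤_) (+-comm (+ 1 / suc k) (+ 1 / suc m)) (x≤x+y _ (0≤1/suc m)))

    root : ℝ
    root = record { seq = approx ; reg = approx-regular }

    f[root]≈0 : ∀ k → ∃[ N ] ∀ m → N ℕ.≤ m → ∣ f (ℝ.seq root m) ∣ ≤ + 1 / suc k
    f[root]≈0 k = N , λ m N≤m → begin
      ∣ f (approx m) ∣                            ≤⟨ ∣f[left]∣≤ (W ℕ.+ m) ⟩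
      fromℕ L * (fromℕ W * half ^ (W ℕ.+ m))     ≡⟨ trans (sym (*-assoc (fromℕ L) (fromℕ W) _)) (cong (_* half ^ (W ℕ.+ m)) (sym (fromℕ-* L W))) ⟩
      fromℕ (L ℕ.* W) * half ^ (W ℕ.+ m)         ≤⟨ *half^j≤1/suc (L ℕ.* W) k (W ℕ.+ m)
                                                       (ℕ.≤-trans (ℕ.<⇒≤ (n<2^n N)) (ℕ.^-monoʳ-≤ 2 (ℕ.≤-trans N≤m (ℕ.m≤n+m m W)))) ⟩
      + 1 / suc k                                 ∎
      where
      open ≤-Reasoning
      N : ℕ
      N = L ℕ.* W ℕ.* suc k

    lo≤root : ∀ m → lo ≤ ℝ.seq root m
    lo≤root m = lo≤a (bracket-bracketing (W ℕ.+ m))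

module Subsets where

  open import Data.Nat as ℕ using (ℕ; zero; suc; _≤_; _<_; _∸_)
  import Data.Nat.Properties as ℕ
  open import Data.Fin using (Fin; zero; suc; toℕ)
  open import Data.Bool as Bool using (true; false; if_then_else_)
  open import Data.Product using (_,_; proj₁; proj₂)
  open import Data.List using (List; []; _∷_; _++_; _∷ʳ_; filter; map; length; foldr; concatMap; upTo)
  import Data.List.Properties as List
  open import Data.Rational using (ℚ; 0ℚ; 1ℚ; _+_; _*_; _-_)
  open import Data.Rational.Properties using (+-identityˡ; +-identityʳ; +-assoc; *-zeroʳ; *-distribˡ-+)
  open import Relation.Nullary using (does)
  open import Relation.Unary using (Decidable)
  open import Relation.Binary.PropositionalEquality
  open RationalFacts using (module QS)

  tail : ∀ {n} → Subset (suc n) → Subset n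
  tail S i = S (suc i)

  filter-map : ∀ {A B : Set} {P : B → Set} (P? : Decidable P) (g : A → B) xs →
    filter P? (map g xs) ≡ map g (filter (λ x → P? (g x)) xs)
  filter-map P? g [] = refl
  filter-map P? g (x ∷ xs) with does (P? (g x))
  ... | true  = cong (g x ∷_) (filter-map P? g xs)
  ... | false = filter-map P? g xs

  length-filter-map : ∀ {A B : Set} {P : B → Set} (P? : Decidable P) (g : A → B) xs →
    length (filter P? (map g xs)) ≡ length (filter (λ x → P? (g x)) xs)
  length-filter-map P? g xs = trans (cong length (filter-map P? g xs)) (List.length-map g (filter (λ x → P? (g x)) xs))

  size-tail : ∀ {n} (S : Subset (suc n)) → size S ≡ (if S zero then suc (size (tail S)) else size (tail S))
  size-tail {n} S with S zero
  ... | true  = cong suc (length-filter-map _ suc (allFin n))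
  ... | false = length-filter-map _ suc (allFin n)

  size≤n : ∀ {n} (S : Subset n) → size S ≤ n
  size≤n {zero} S = ℕ.z≤n
  size≤n {suc n} S rewrite size-tail S with S zero
  ... | true  = ℕ.s≤s (size≤n (tail S))
  ... | false = ℕ.m≤n⇒m≤1+n (size≤n (tail S))

  size-pos : ∀ {n} (S : Subset n) i → S i ≡ true → 1 ≤ size S
  size-pos {suc n} S zero Si rewrite size-tail S | Si = ℕ.s≤s ℕ.z≤n
  size-pos {suc n} S (suc i) Si rewrite size-tail S with S zero
  ... | true  = ℕ.s≤s ℕ.z≤n
  ... | false = size-pos (tail S) i Si

  support : ∀ {n} → Subset n → List (Fin n)
  support {n} S = filter (λ i → S i Bool.≟ true) (allFin n)

  support-head : ∀ {n} (S : Subset n) {u rest} → support S ≡ u ∷ rest →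
    S u ≡ true × (∀ w → toℕ w < toℕ u → S w ≡ false)
  support-head {suc n} S {u} eq with S zero in S0
  support-head {suc n} S {.zero} refl | true = S0 , λ _ ()
  ... | false with support (tail S) in e | trans (sym eq) (filter-map (λ i → S i Bool.≟ true) suc (allFin n))
  ...   | u′ ∷ _ | refl = proj₁ (support-head (tail S) e) , below
    where
    below : ∀ w → toℕ w < suc (toℕ u′) → S w ≡ false
    below zero _ = S0
    below (suc w) (ℕ.s≤s w<u′) = proj₂ (support-head (tail S) e) w w<u′

  support-[] : ∀ {n} (S : Subset n) → support S ≡ [] → ∀ i → S i ≡ false
  support-[] {suc n} S eq i with S zero in S0
  ... | false with support (tail S) in e | trans (sym eq) (filter-map (λ i → S i Bool.≟ true) suc (allFin n))
  ...   | [] | _ with i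
  ...     | zero  = S0
  ...     | suc j = support-[] (tail S) e j

  weight : ℚ → ∀ {n} → Subset n → ℚ
  weight p {zero} S = 1ℚ
  weight p {suc n} S = (if S zero then p else 1ℚ - p) * weight p (tail S)

  pow-size≡weight : ∀ G p {n} (S : Subset n) → pow G p (size S) * pow G (1ℚ - p) (n ∸ size S) ≡ weight p S
  pow-size≡weight G p {zero} S = refl
  pow-size≡weight G p {suc n} S rewrite size-tail S with S zero
  ... | true = trans (QS.solve 3 (λ a b c → (a QS.:* b) QS.:* c QS.:= a QS.:* (b QS.:* c)) refl p (pow G p s) (pow G (1ℚ - p) (n ∸ s)))
                     (cong (p *_) (pow-size≡weight G p (tail S)))
    where
    s : ℕ
    s = size (tail S)
  ... | false rewrite ℕ.+-∸-assoc 1 (size≤n (tail S)) =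
          trans (QS.solve 3 (λ a b c → a QS.:* (b QS.:* c) QS.:= b QS.:* (a QS.:* c)) refl (pow G p s) (1ℚ - p) (pow G (1ℚ - p) (n ∸ s)))
                (cong ((1ℚ - p) *_) (pow-size≡weight G p (tail S)))
    where
    s : ℕ
    s = size (tail S)

  ∑ : ∀ {A : Set} → (A → ℚ) → List A → ℚ
  ∑ F = foldr (λ x acc → F x + acc) 0ℚ

  ∑-cong : ∀ {A : Set} {F G : A → ℚ} → (∀ x → F x ≡ G x) → ∀ xs → ∑ F xs ≡ ∑ G xs
  ∑-cong F≡G [] = refl
  ∑-cong F≡G (x ∷ xs) = cong₂ _+_ (F≡G x) (∑-cong F≡G xs)

  ∑-++ : ∀ {A : Set} (F : A → ℚ) xs ys → ∑ F (xs ++ ys) ≡ ∑ F xs + ∑ F ys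
  ∑-++ F [] ys = sym (+-identityˡ _)
  ∑-++ F (x ∷ xs) ys = trans (cong (F x +_) (∑-++ F xs ys)) (sym (+-assoc (F x) (∑ F xs) (∑ F ys)))

  ∑-concatMap : ∀ {A B : Set} (F : B → ℚ) (f : A → List B) xs → ∑ F (concatMap f xs) ≡ ∑ (λ x → ∑ F (f x)) xs
  ∑-concatMap F f [] = refl
  ∑-concatMap F f (x ∷ xs) = trans (∑-++ F (f x) (concatMap f xs)) (cong (∑ F (f x) +_) (∑-concatMap F f xs))

  ∑-+ : ∀ {A : Set} (F G : A → ℚ) xs → ∑ (λ x → F x + G x) xs ≡ ∑ F xs + ∑ G xs
  ∑-+ F G [] = refl
  ∑-+ F G (x ∷ xs) = trans (cong (F x + G x +_) (∑-+ F G xs))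
    (QS.solve 4 (λ a b c d → (a QS.:+ b) QS.:+ (c QS.:+ d) QS.:= (a QS.:+ c) QS.:+ (b QS.:+ d)) refl (F x) (G x) (∑ F xs) (∑ G xs))

  ∑-*ˡ : ∀ {A : Set} a (F : A → ℚ) xs → ∑ (λ x → a * F x) xs ≡ a * ∑ F xs
  ∑-*ˡ a F [] = sym (*-zeroʳ a)
  ∑-*ˡ a F (x ∷ xs) = trans (cong (a * F x +_) (∑-*ˡ a F xs)) (sym (*-distribˡ-+ a (F x) (∑ F xs)))

  ∑-zero : ∀ {A : Set} xs → ∑ {A} (λ _ → 0ℚ) xs ≡ 0ℚ
  ∑-zero [] = refl
  ∑-zero (x ∷ xs) = trans (+-identityˡ _) (∑-zero xs)

  ∑-upTo-suc : ∀ (F : ℕ → ℚ) n → ∑ F (map suc (upTo (suc n))) ≡ ∑ F (map suc (upTo n)) + F (suc n)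
  ∑-upTo-suc F n = begin
    ∑ F (map suc (upTo (suc n)))               ≡⟨ cong (λ ks → ∑ F (map suc ks)) (List.upTo-∷ʳ n) ⟨
    ∑ F (map suc (upTo n ∷ʳ n))                ≡⟨ cong (∑ F) (List.map-++ suc (upTo n) (n ∷ [])) ⟩
    ∑ F (map suc (upTo n) ++ suc n ∷ [])       ≡⟨ ∑-++ F (map suc (upTo n)) (suc n ∷ []) ⟩
    ∑ F (map suc (upTo n)) + (F (suc n) + 0ℚ)  ≡⟨ cong (∑ F (map suc (upTo n)) +_) (+-identityʳ (F (suc n))) ⟩
    ∑ F (map suc (upTo n)) + F (suc n)         ∎
    where open ≡-Reasoning

module NRelExpansion where

  open import Data.Nat as ℕ using (ℕ; zero; suc; _≤_; _<_; _∸_)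
  import Data.Nat.Properties as ℕ
  open import Data.Integer using (+_)
  open import Data.Bool as Bool using (Bool; true; false; _∧_; if_then_else_)
  open import Data.List using (List; []; _∷_; filter; map; length; upTo)
  import Data.List.Properties as List
  open import Data.Rational using (ℚ; 0ℚ; 1ℚ; _+_; _*_; _-_; _/_)
  open import Data.Rational.Properties using (+-identityˡ; +-identityʳ; *-zeroˡ; *-identityˡ; *-assoc; *-distribʳ-+)
  open import Data.Product using (proj₁)
  open import Data.Sum using (inj₁; inj₂)
  open import Relation.Nullary.Decidable using (⌊_⌋)
  open import Relation.Binary.PropositionalEquality
  open RationalFacts using (fromℕ; fromℕ-+; fromℕ≡/1)
  open Subsets

  indicator : Bool → ℚ → ℚ
  indicator b x = if b then x else 0ℚ

  fromℕ-if : ∀ b x → fromℕ (if b then 1 else 0) * x ≡ indicator b x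
  fromℕ-if true  x = *-identityˡ x
  fromℕ-if false x = *-zeroˡ x

  module _ (V : ℕ → ℚ) where

    point-mass : ℕ → ℕ → ℚ
    point-mass s k = indicator ⌊ s ℕ.≟ k ⌋ (V k)

    point-mass-≢ : ∀ {s k} → s ≢ k → point-mass s k ≡ 0ℚ
    point-mass-≢ {s} {k} s≢k = cong (λ d → indicator ⌊ d ⌋ (V k)) (≢-≟-identity ℕ._≟_ s≢k)

    point-mass-≡ : ∀ s → point-mass s s ≡ V s
    point-mass-≡ s = cong (λ d → indicator ⌊ d ⌋ (V s)) (ℕ.≟-diag refl)

    ∑-point-mass-out : ∀ n s → n < s → ∑ (point-mass s) (map suc (upTo n)) ≡ 0ℚ
    ∑-point-mass-out zero s _ = refl
    ∑-point-mass-out (suc n) s n<s = begin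
      ∑ (point-mass s) (map suc (upTo (suc n)))                    ≡⟨ ∑-upTo-suc (point-mass s) n ⟩
      ∑ (point-mass s) (map suc (upTo n)) + point-mass s (suc n)   ≡⟨ cong₂ _+_ (∑-point-mass-out n s (ℕ.<-trans (ℕ.n<1+n n) n<s))
                                                                                (point-mass-≢ (λ s≡ → ℕ.<-irrefl (sym s≡) n<s)) ⟩
      0ℚ + 0ℚ                                                      ≡⟨ +-identityʳ 0ℚ ⟩
      0ℚ                                                           ∎
      where open ≡-Reasoning

    ∑-point-mass-in : ∀ n s → 1 ≤ s → s ≤ n → ∑ (point-mass s) (map suc (upTo n)) ≡ V s
    ∑-point-mass-in zero (suc s) _ ()
    ∑-point-mass-in (suc n) s 1≤s s≤1+n with ℕ.m≤n⇒m<n∨m≡n s≤1+n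
    ... | inj₁ s<1+n = begin
      ∑ (point-mass s) (map suc (upTo (suc n)))                    ≡⟨ ∑-upTo-suc (point-mass s) n ⟩
      ∑ (point-mass s) (map suc (upTo n)) + point-mass s (suc n)   ≡⟨ cong₂ _+_ (∑-point-mass-in n s 1≤s (ℕ.≤-pred s<1+n))
                                                                                (point-mass-≢ (λ s≡ → ℕ.<-irrefl s≡ s<1+n)) ⟩
      V s + 0ℚ                                                     ≡⟨ +-identityʳ (V s) ⟩
      V s                                                          ∎
      where open ≡-Reasoning
    ... | inj₂ refl = begin
      ∑ (point-mass s) (map suc (upTo (suc n)))                    ≡⟨ ∑-upTo-suc (point-mass s) n ⟩
      ∑ (point-mass s) (map suc (upTo n)) + point-mass s (suc n)   ≡⟨ cong₂ _+_ (∑-point-mass-out n s (ℕ.n<1+n n)) (point-mass-≡ s) ⟩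
      0ℚ + V s                                                     ≡⟨ +-identityˡ (V s) ⟩
      V s                                                          ∎
      where open ≡-Reasoning

  connected⇒size-pos : ∀ G S → isConnectedSet G S ≡ true → 1 ≤ size S
  connected⇒size-pos G S conn with support S in e
  ... | u ∷ _ = size-pos S u (proj₁ (support-head S e))

  module _ (G : Graph) (p : ℚ) where
    open Graph G using (n)

    ks : List ℕ
    ks = map suc (upTo n)

    V : ℕ → ℚ
    V k = pow G p k * pow G (1ℚ - p) (n ∸ k)

    count : List (Subset n) → ℕ → ℕ
    count L k = length (filter (λ S → (isConnectedSet G S ∧ ⌊ size S ℕ.≟ k ⌋) Bool.≟ true) L)

    count-∷ : ∀ S L k → count (S ∷ L) k ≡ (if isConnectedSet G S ∧ ⌊ size S ℕ.≟ k ⌋ then 1 else 0) ℕ.+ count L k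
    count-∷ S L k with isConnectedSet G S ∧ ⌊ size S ℕ.≟ k ⌋
    ... | true  = refl
    ... | false = refl

    term : Subset n → ℕ → ℚ
    term S k = fromℕ (if isConnectedSet G S ∧ ⌊ size S ℕ.≟ k ⌋ then 1 else 0) * V k

    ∑-term : ∀ S → ∑ (term S) ks ≡ indicator (isConnectedSet G S) (V (size S))
    ∑-term S with isConnectedSet G S in conn
    ... | false = trans (∑-cong (λ k → *-zeroˡ (V k)) ks) (∑-zero ks)
    ... | true  = trans (∑-cong (λ k → fromℕ-if ⌊ size S ℕ.≟ k ⌋ (V k)) ks)
                        (∑-point-mass-in V n (size S) (connected⇒size-pos G S conn) (size≤n S))

    ∑-count : ∀ L → ∑ (λ k → fromℕ (count L k) * V k) ks ≡ ∑ (λ S → indicator (isConnectedSet G S) (V (size S))) L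
    ∑-count [] = trans (∑-cong (λ k → *-zeroˡ (V k)) ks) (∑-zero ks)
    ∑-count (S ∷ L) = begin
      ∑ (λ k → fromℕ (count (S ∷ L) k) * V k) ks                    ≡⟨ ∑-cong split ks ⟩
      ∑ (λ k → term S k + fromℕ (count L k) * V k) ks               ≡⟨ ∑-+ (term S) _ ks ⟩
      ∑ (term S) ks + ∑ (λ k → fromℕ (count L k) * V k) ks          ≡⟨ cong₂ _+_ (∑-term S) (∑-count L) ⟩
      indicator (isConnectedSet G S) (V (size S)) + ∑ (λ S → indicator (isConnectedSet G S) (V (size S))) L ∎
      where
      open ≡-Reasoning
      split : ∀ k → fromℕ (count (S ∷ L) k) * V k ≡ term S k + fromℕ (count L k) * V k
      split k = trans (cong (λ c → fromℕ c * V k) (count-∷ S L k))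
        (trans (cong (_* V k) (fromℕ-+ (if isConnectedSet G S ∧ ⌊ size S ℕ.≟ k ⌋ then 1 else 0) (count L k)))
               (*-distribʳ-+ (V k) (fromℕ (if isConnectedSet G S ∧ ⌊ size S ℕ.≟ k ⌋ then 1 else 0)) (fromℕ (count L k))))

    NRel≡∑-connected : NRel G p ≡ ∑ (λ S → indicator (isConnectedSet G S) (weight p S)) (allSubsets n)
    NRel≡∑-connected = begin
      NRel G p                                                     ≡⟨ ∑-cong coefficient ks ⟩
      ∑ (λ k → fromℕ (c G k) * V k) ks                              ≡⟨ ∑-count (allSubsets n) ⟩
      ∑ (λ S → indicator (isConnectedSet G S) (V (size S))) (allSubsets n)
        ≡⟨ ∑-cong (λ S → cong (indicator (isConnectedSet G S)) (pow-size≡weight G p S)) (allSubsets n) ⟩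
      ∑ (λ S → indicator (isConnectedSet G S) (weight p S)) (allSubsets n) ∎
      where
      open ≡-Reasoning
      coefficient : ∀ k → (+ c G k / 1) * pow G p k * pow G (1ℚ - p) (n ∸ k) ≡ fromℕ (c G k) * V k
      coefficient k = trans (cong (λ x → x * pow G p k * pow G (1ℚ - p) (n ∸ k)) (sym (fromℕ≡/1 (c G k))))
                            (*-assoc (fromℕ (c G k)) _ _)

module Path where

  open import Data.Nat as ℕ using (ℕ; zero; suc; _≤_; _<_; _+_; z≤n; s≤s)
  import Data.Nat.Properties as ℕ
  open import Data.Fin as Fin using (Fin; zero; suc; toℕ; inject₁)
  import Data.Fin.Properties as Fin
  open import Data.Bool as Bool using (Bool; true; false; _∧_; _∨_; not; if_then_else_)
  import Data.Bool.Properties as Bool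
  open import Data.Bool.ListAction using (any; all; or; and)
  open import Data.List using ([]; _∷_)
  import Data.List.Properties as List
  open import Data.Product using (_,_; proj₁; proj₂)
  open import Data.Sum using (_⊎_; inj₁; inj₂)
  open import Data.Empty using (⊥-elim)
  open import Relation.Nullary using (yes; no)
  open import Relation.Nullary.Decidable using (⌊_⌋)
  open import Relation.Binary.PropositionalEquality
  open import Function.Bundles using (Equivalence; mk⇔)
  open Subsets using (tail; support; support-head; support-[])

  ∨-true : ∀ {a b} → a ∨ b ≡ true → a ≡ true ⊎ b ≡ true
  ∨-true {true}  _ = inj₁ refl
  ∨-true {false} b = inj₂ b

  ∧-true : ∀ {a b} → a ∧ b ≡ true → a ≡ true × b ≡ true
  ∧-true {true} b = refl , b

  true≢false : true ≢ false
  true≢false ()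

  any-allFin⁻ : ∀ {n} (p : Fin n → Bool) → any p (allFin n) ≡ true → ∃ λ i → p i ≡ true
  any-allFin⁻ {suc n} p h with p zero in p0
  ... | true  = zero , p0
  ... | false with any-allFin⁻ (λ i → p (suc i)) (trans (cong or (List.map-∘ (allFin n))) h)
  ...   | i , pi = suc i , pi

  any-allFin⁺ : ∀ {n} (p : Fin n → Bool) i → p i ≡ true → any p (allFin n) ≡ true
  any-allFin⁺ {suc n} p zero pi rewrite pi = refl
  any-allFin⁺ {suc n} p (suc i) pi =
    trans (cong (p zero ∨_) (trans (sym (cong or (List.map-∘ (allFin n)))) (any-allFin⁺ (λ i → p (suc i)) i pi)))
          (Bool.∨-zeroʳ (p zero))

  all-allFin⁻ : ∀ {n} (p : Fin n → Bool) → all p (allFin n) ≡ true → ∀ i → p i ≡ true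
  all-allFin⁻ {suc n} p h zero = proj₁ (∧-true h)
  all-allFin⁻ {suc n} p h (suc i) =
    all-allFin⁻ (λ i → p (suc i)) (trans (cong and (List.map-∘ (allFin n))) (proj₂ (∧-true {p zero} h))) i

  all-allFin⁺ : ∀ {n} (p : Fin n → Bool) → (∀ i → p i ≡ true) → all p (allFin n) ≡ true
  all-allFin⁺ {zero} p h = refl
  all-allFin⁺ {suc n} p h rewrite h zero =
    trans (sym (cong and (List.map-∘ (allFin n)))) (all-allFin⁺ (λ i → p (suc i)) (λ i → h (suc i)))

  implication⁻ : ∀ {a b} → a ≡ true → (if a then b else true) ≡ true → b ≡ true
  implication⁻ refl b = b

  implication⁺ : ∀ {a b} → (a ≡ true → b ≡ true) → (if a then b else true) ≡ true
  implication⁺ {true}  a⇒b = a⇒b refl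
  implication⁺ {false} _   = refl

  module _ (G : Graph) where
    open Graph G using (n; adj)

    step-elim : ∀ S R v → step G S R v ≡ true →
      R v ≡ true ⊎ (S v ≡ true × ∃ λ w → R w ≡ true × adj w v ≡ true)
    step-elim S R v h with ∨-true {R v} h
    ... | inj₁ Rv = inj₁ Rv
    ... | inj₂ h′ with ∧-true {S v} h′
    ...   | Sv , ∃w with any-allFin⁻ (λ w → R w ∧ adj w v) ∃w
    ...     | w , Rw∧adj = inj₂ (Sv , w , ∧-true Rw∧adj)

    step-intro : ∀ S R v w → R w ≡ true → adj w v ≡ true → S v ≡ true → step G S R v ≡ true
    step-intro S R v w Rw adjwv Sv rewrite Sv | any-allFin⁺ (λ w → R w ∧ adj w v) w (cong₂ _∧_ Rw adjwv) = Bool.∨-zeroʳ (R v)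

    step-extensive : ∀ S R v → R v ≡ true → step G S R v ≡ true
    step-extensive S R v Rv rewrite Rv = refl

  adjacent : ∀ {n} → Fin n → Fin n → Bool
  adjacent i j = (suc (toℕ i) ℕ.≡ᵇ toℕ j) ∨ (suc (toℕ j) ℕ.≡ᵇ toℕ i)

  1+n≢ᵇn : ∀ n → (suc n ℕ.≡ᵇ n) ≡ false
  1+n≢ᵇn zero = refl
  1+n≢ᵇn (suc n) = 1+n≢ᵇn n

  -- path n has the n + 1 nodes 0, 1, …, n.
  path : ℕ → Graph
  path n = record
    { n = suc n ; nonempty = s≤s z≤n ; adj = adjacent
    ; sym = λ u v → Bool.∨-comm (suc (toℕ u) ℕ.≡ᵇ toℕ v) (suc (toℕ v) ℕ.≡ᵇ toℕ u)
    ; irrefl = λ u → cong (λ b → b ∨ b) (1+n≢ᵇn (toℕ u)) }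

  adjacent⁻ : ∀ {n} (i j : Fin n) → adjacent i j ≡ true → suc (toℕ i) ≡ toℕ j ⊎ suc (toℕ j) ≡ toℕ i
  adjacent⁻ i j h with ∨-true {suc (toℕ i) ℕ.≡ᵇ toℕ j} h
  ... | inj₁ e = inj₁ (ℕ.≡ᵇ⇒≡ _ _ (Equivalence.from Bool.T-≡ e))
  ... | inj₂ e = inj₂ (ℕ.≡ᵇ⇒≡ _ _ (Equivalence.from Bool.T-≡ e))

  predecessor : ∀ {m} (v : Fin m) {k} → toℕ v ≡ suc k → ∃ λ (w : Fin m) → toℕ w ≡ k
  predecessor (suc v) v≡ = inject₁ v , trans (Fin.toℕ-inject₁ v) (ℕ.suc-injective v≡)

  -- Breadth-first search from the least element u of S reaches, after t steps,
  -- exactly the nodes v ≤ u + t with [u, v] ⊆ S.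
  module Reachability (n : ℕ) (S : Subset (suc n)) (u : Fin (suc n)) (Su : S u ≡ true)
    (u-least : ∀ w → toℕ w < toℕ u → S w ≡ false) where

    Filled : Fin (suc n) → Set
    Filled v = ∀ w → toℕ u ≤ toℕ w → toℕ w ≤ toℕ v → S w ≡ true

    Spans : ℕ → Fin (suc n) → Set
    Spans t v = toℕ u ≤ toℕ v × toℕ v ≤ toℕ u + t × Filled v

    reached : ℕ → Subset (suc n)
    reached t = iter (path n) t (step (path n) S) (λ v → ⌊ v Fin.≟ u ⌋)

    u≤ : ∀ {v} → S v ≡ true → toℕ u ≤ toℕ v
    u≤ {v} Sv with ℕ.≤-<-connex (toℕ u) (toℕ v)
    ... | inj₁ u≤v = u≤v
    ... | inj₂ v<u = ⊥-elim (true≢false (trans (sym Sv) (u-least v v<u)))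

    spans-u : Spans 0 u
    spans-u = ℕ.≤-refl , ℕ.m≤m+n (toℕ u) 0 ,
      λ w u≤w w≤u → subst (λ x → S x ≡ true) (sym (Fin.toℕ-injective (ℕ.≤-antisym w≤u u≤w))) Su

    spans-suc : ∀ {t v} → Spans t v → Spans (suc t) v
    spans-suc {t} (u≤v , v≤u+t , filled) = u≤v , ℕ.≤-trans v≤u+t (ℕ.+-monoʳ-≤ (toℕ u) (ℕ.n≤1+n t)) , filled

    spans-right : ∀ {t v w} → Spans t w → suc (toℕ w) ≡ toℕ v → S v ≡ true → Spans (suc t) v
    spans-right {t} {v} {w} (u≤w , w≤u+t , filled) w+1≡v Sv =
      ℕ.≤-trans u≤w (subst (toℕ w ≤_) w+1≡v (ℕ.n≤1+n _)) ,
      subst (_≤ toℕ u + suc t) w+1≡v (subst (suc (toℕ w) ≤_) (sym (ℕ.+-suc (toℕ u) t)) (s≤s w≤u+t)) ,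
      filled′
      where
      filled′ : Filled v
      filled′ x u≤x x≤v with ℕ.m≤n⇒m<n∨m≡n x≤v
      ... | inj₁ x<v = filled x u≤x (ℕ.≤-pred (subst (suc (toℕ x) ≤_) (sym w+1≡v) x<v))
      ... | inj₂ x≡v = subst (λ y → S y ≡ true) (sym (Fin.toℕ-injective x≡v)) Sv

    spans-left : ∀ {t v w} → Spans t w → suc (toℕ v) ≡ toℕ w → S v ≡ true → Spans (suc t) v
    spans-left {t} {v} {w} (u≤w , w≤u+t , filled) v+1≡w Sv =
      u≤ Sv , ℕ.≤-trans v≤w (ℕ.≤-trans w≤u+t (ℕ.+-monoʳ-≤ (toℕ u) (ℕ.n≤1+n t))) ,
      λ x u≤x x≤v → filled x u≤x (ℕ.≤-trans x≤v v≤w)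
      where
      v≤w : toℕ v ≤ toℕ w
      v≤w = subst (toℕ v ≤_) v+1≡w (ℕ.n≤1+n _)

    reached-sound : ∀ t v → reached t v ≡ true → Spans t v
    reached-sound zero v h with v Fin.≟ u
    ... | yes refl = spans-u
    reached-sound (suc t) v h with step-elim (path n) S (reached t) v h
    ... | inj₁ Rv = spans-suc (reached-sound t v Rv)
    ... | inj₂ (Sv , w , Rw , adjwv) with adjacent⁻ w v adjwv
    ...   | inj₁ w+1≡v = spans-right (reached-sound t w Rw) w+1≡v Sv
    ...   | inj₂ v+1≡w = spans-left (reached-sound t w Rw) v+1≡w Sv

    reached-complete : ∀ t v → Spans t v → reached t v ≡ true
    reached-complete zero v (u≤v , v≤u+0 , _)
      with Fin.toℕ-injective {i = v} {j = u} (ℕ.≤-antisym (subst (toℕ v ≤_) (ℕ.+-identityʳ (toℕ u)) v≤u+0) u≤v)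
    ... | refl = cong ⌊_⌋ (≡-≟-identity Fin._≟_ {u} refl)
    reached-complete (suc t) v (u≤v , v≤u+t+1 , filled) with toℕ v ℕ.≤? toℕ u + t
    ... | yes v≤u+t = step-extensive (path n) S (reached t) v (reached-complete t v (u≤v , v≤u+t , filled))
    ... | no  v≰u+t = step-intro (path n) S (reached t) v w Rw adjwv (filled v u≤v ℕ.≤-refl)
      where
      v≡ : toℕ v ≡ suc (toℕ u + t)
      v≡ = ℕ.≤-antisym (subst (toℕ v ≤_) (ℕ.+-suc (toℕ u) t) v≤u+t+1) (ℕ.≰⇒> v≰u+t)
      w : Fin (suc n)
      w = proj₁ (predecessor v v≡)
      w≡ : toℕ w ≡ toℕ u + t
      w≡ = proj₂ (predecessor v v≡)
      Rw : reached t w ≡ true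
      Rw = reached-complete t w (subst (toℕ u ≤_) (sym w≡) (ℕ.m≤m+n (toℕ u) t) , ℕ.≤-reflexive w≡ ,
             λ x u≤x x≤w → filled x u≤x (ℕ.≤-trans x≤w (subst₂ _≤_ (sym w≡) (sym v≡) (ℕ.n≤1+n _))))
      adjwv : adjacent w v ≡ true
      adjwv = cong (_∨ (suc (toℕ v) ℕ.≡ᵇ toℕ w)) (Equivalence.to Bool.T-≡ (ℕ.≡⇒≡ᵇ _ _ (trans (cong suc w≡) (sym v≡))))

  NonEmpty : ∀ {n} → Subset n → Set
  NonEmpty S = ∃ λ i → S i ≡ true

  Convex : ∀ {n} → Subset n → Set
  Convex S = ∀ a w b → toℕ a ≤ toℕ w → toℕ w ≤ toℕ b → S a ≡ true → S b ≡ true → S w ≡ true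

  connected⇒convex : ∀ n (S : Subset (suc n)) → isConnectedSet (path n) S ≡ true → NonEmpty S × Convex S
  connected⇒convex n S conn with support S in e
  ... | u ∷ _ = (u , Su) , convex
    where
    Su : S u ≡ true
    Su = proj₁ (support-head S e)
    open Reachability n S u Su (proj₂ (support-head S e))
    convex : Convex S
    convex a w b a≤w w≤b Sa Sb =
      proj₂ (proj₂ (reached-sound (suc n) b (implication⁻ Sb (all-allFin⁻ _ conn b)))) w (ℕ.≤-trans (u≤ Sa) a≤w) w≤b

  convex⇒connected : ∀ n (S : Subset (suc n)) → NonEmpty S → Convex S → isConnectedSet (path n) S ≡ true
  convex⇒connected n S (i , Si) convex with support S in e
  ... | [] = ⊥-elim (true≢false (trans (sym Si) (support-[] S e i)))
  ... | u ∷ _ = all-allFin⁺ _ (λ v → implication⁺ (λ Sv → reached-complete (suc n) v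
          (u≤ Sv , ℕ.≤-trans (ℕ.<⇒≤ (Fin.toℕ<n v)) (ℕ.m≤n+m (suc n) (toℕ u)) , λ x u≤x x≤v → convex u x v u≤x x≤v Su Sv)))
    where
    Su : S u ≡ true
    Su = proj₁ (support-head S e)
    open Reachability n S u Su (proj₂ (support-head S e))

  empty? : ∀ {n} → Subset n → Bool
  empty? {zero}  S = true
  empty? {suc n} S = not (S zero) ∧ empty? (tail S)

  prefix? : ∀ {n} → Subset n → Bool
  prefix? {zero}  S = true
  prefix? {suc n} S = if S zero then prefix? (tail S) else empty? (tail S)

  interval? : ∀ {n} → Subset n → Bool
  interval? {zero}  S = false
  interval? {suc n} S = if S zero then prefix? (tail S) else interval? (tail S)

  DownClosed : ∀ {n} → Subset n → Set
  DownClosed S = ∀ i j → toℕ i ≤ toℕ j → S j ≡ true → S i ≡ true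

  empty?⇒ : ∀ {n} (S : Subset n) → empty? S ≡ true → ∀ i → S i ≡ false
  empty?⇒ {suc n} S h i with S zero in S0
  ... | false with i
  ...   | zero  = S0
  ...   | suc j = empty?⇒ (tail S) h j

  empty?⇐ : ∀ {n} (S : Subset n) → (∀ i → S i ≡ false) → empty? S ≡ true
  empty?⇐ {zero}  S h = refl
  empty?⇐ {suc n} S h rewrite h zero = empty?⇐ (tail S) (λ i → h (suc i))

  prefix?⇒ : ∀ {n} (S : Subset n) → prefix? S ≡ true → DownClosed S
  prefix?⇒ {suc n} S h i j i≤j Sj with S zero in S0
  prefix?⇒ {suc n} S h zero    j       _         Sj | true = S0
  prefix?⇒ {suc n} S h (suc i) (suc j) (s≤s i≤j) Sj | true = prefix?⇒ (tail S) h i j i≤j Sj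
  prefix?⇒ {suc n} S h zero    zero    _         Sj | false = Sj
  prefix?⇒ {suc n} S h i       (suc j) _         Sj | false = ⊥-elim (true≢false (trans (sym Sj) (empty?⇒ (tail S) h j)))

  prefix?⇐ : ∀ {n} (S : Subset n) → DownClosed S → prefix? S ≡ true
  prefix?⇐ {zero}  S h = refl
  prefix?⇐ {suc n} S h with S zero in S0
  ... | true  = prefix?⇐ (tail S) (λ i j i≤j Sj → h (suc i) (suc j) (s≤s i≤j) Sj)
  ... | false = empty?⇐ (tail S) (λ i → not-true i (tail S i) refl)
    where
    not-true : ∀ i b → tail S i ≡ b → b ≡ false
    not-true i false _  = refl
    not-true i true  Si = ⊥-elim (true≢false (trans (sym (h zero (suc i) z≤n Si)) S0))

  interval?⇒ : ∀ {n} (S : Subset n) → interval? S ≡ true → NonEmpty S × Convex S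
  interval?⇒ {suc n} S h with S zero in S0
  ... | true = (zero , S0) , convex
    where
    convex : Convex S
    convex a zero    b       _ _         _ _  = S0
    convex a (suc w) (suc b) _ (s≤s w≤b) _ Sb = prefix?⇒ (tail S) h w b w≤b Sb
  ... | false = (suc (proj₁ (proj₁ IH)) , proj₂ (proj₁ IH)) , convex
    where
    IH = interval?⇒ (tail S) h
    convex : Convex S
    convex zero    _       _       _         _         Sa _  = ⊥-elim (true≢false (trans (sym Sa) S0))
    convex (suc a) (suc w) (suc b) (s≤s a≤w) (s≤s w≤b) Sa Sb = proj₂ IH a w b a≤w w≤b Sa Sb

  interval?⇐ : ∀ {n} (S : Subset n) → NonEmpty S → Convex S → interval? S ≡ true
  interval?⇐ {suc n} S (i , Si) convex with S zero in S0
  ... | true = prefix?⇐ (tail S) (λ i j i≤j Sj → convex zero (suc i) (suc j) z≤n (s≤s i≤j) S0 Sj)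
  ... | false with i
  ...   | zero   = ⊥-elim (true≢false (trans (sym Si) S0))
  ...   | suc i′ = interval?⇐ (tail S) (i′ , Si)
                     (λ a w b a≤w w≤b Sa Sb → convex (suc a) (suc w) (suc b) (s≤s a≤w) (s≤s w≤b) Sa Sb)

  connected≡interval? : ∀ n (S : Subset (suc n)) → isConnectedSet (path n) S ≡ interval? S
  connected≡interval? n S = Bool.⇔→≡ {z = true} (mk⇔
    (λ conn → let (nonEmpty , convex) = connected⇒convex n S conn in interval?⇐ S nonEmpty convex)
    (λ int  → let (nonEmpty , convex) = interval?⇒ S int in convex⇒connected n S nonEmpty convex))

module PathReliability where

  open import Data.Nat using (zero; suc)
  open import Data.Bool using (Bool; true; false)
  open import Data.Rational using (ℚ; 0ℚ; 1ℚ; _+_; _*_; _-_; +-*-rawSemiring)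
  open import Data.Rational.Properties using (*-zeroʳ; +-identityʳ)
  open import Algebra.Definitions.RawSemiring +-*-rawSemiring using (_^_)
  open import Relation.Binary.PropositionalEquality
  open RationalFacts using (fromℕ; module QS)
  open Subsets
  open NRelExpansion using (indicator; NRel≡∑-connected)
  open Path

  module _ (p : ℚ) where

    q : ℚ
    q = 1ℚ - p

    mass : ∀ {n} → (Subset n → Bool) → ℚ
    mass {n} P = ∑ (λ S → indicator (P S) (weight p S)) (allSubsets n)

    indicator-* : ∀ b c x → indicator b (c * x) ≡ c * indicator b x
    indicator-* true  c x = refl
    indicator-* false c x = sym (*-zeroʳ c)

    -- allSubsets (suc n) extends each subset of the remaining nodes by node 0 being absent (factor q) or present (factor p).
    ∑-first-node : ∀ {n} (A B : Subset n → Bool) →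
      ∑ (λ S → indicator (A S) (q * weight p S) + (indicator (B S) (p * weight p S) + 0ℚ)) (allSubsets n)
        ≡ q * mass A + p * mass B
    ∑-first-node {n} A B = begin
      ∑ (λ S → indicator (A S) (q * weight p S) + (indicator (B S) (p * weight p S) + 0ℚ)) (allSubsets n)
        ≡⟨ ∑-cong (λ S → cong₂ _+_ (indicator-* (A S) q (weight p S))
                                   (trans (+-identityʳ _) (indicator-* (B S) p (weight p S)))) (allSubsets n) ⟩
      ∑ (λ S → q * indicator (A S) (weight p S) + p * indicator (B S) (weight p S)) (allSubsets n)
        ≡⟨ ∑-+ (λ S → q * indicator (A S) (weight p S)) (λ S → p * indicator (B S) (weight p S)) (allSubsets n) ⟩
      ∑ (λ S → q * indicator (A S) (weight p S)) (allSubsets n) + ∑ (λ S → p * indicator (B S) (weight p S)) (allSubsets n)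
        ≡⟨ cong₂ _+_ (∑-*ˡ q _ (allSubsets n)) (∑-*ˡ p _ (allSubsets n)) ⟩
      q * mass A + p * mass B ∎
      where open ≡-Reasoning

    mass-empty? : ∀ n → mass (empty? {n}) ≡ q ^ n
    mass-empty? zero = +-identityʳ 1ℚ
    mass-empty? (suc n) = begin
      mass (empty? {suc n})             ≡⟨ ∑-concatMap (λ S → indicator (empty? S) (weight p S)) _ (allSubsets n) ⟩
      _                                 ≡⟨ ∑-first-node {n} empty? (λ _ → false) ⟩
      q * mass (empty? {n}) + p * mass {n} (λ _ → false) ≡⟨ cong₂ (λ x y → q * x + p * y) (mass-empty? n) (∑-zero (allSubsets n)) ⟩
      q * q ^ n + p * 0ℚ                ≡⟨ trans (cong (q * q ^ n +_) (*-zeroʳ p)) (+-identityʳ _) ⟩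
      q ^ suc n                         ∎
      where open ≡-Reasoning

    mass-prefix?-suc : ∀ n → mass (prefix? {suc n}) ≡ q * mass (empty? {n}) + p * mass (prefix? {n})
    mass-prefix?-suc n = trans (∑-concatMap (λ S → indicator (prefix? S) (weight p S)) _ (allSubsets n))
                               (∑-first-node {n} empty? prefix?)

    mass-interval?-suc : ∀ n → mass (interval? {suc n}) ≡ q * mass (interval? {n}) + p * mass (prefix? {n})
    mass-interval?-suc n = trans (∑-concatMap (λ S → indicator (interval? S) (weight p S)) _ (allSubsets n))
                                 (∑-first-node {n} interval? prefix?)

    mass-prefix? : ∀ n → (q - p) * mass (prefix? {n}) ≡ q ^ suc n - p ^ suc n
    mass-prefix? zero = QS.solve 2 (λ p q → (q QS.:- p) QS.:* (QS.con 1ℚ QS.:+ QS.con 0ℚ) QS.:= q QS.:* QS.con 1ℚ QS.:- p QS.:* QS.con 1ℚ) refl p q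
    mass-prefix? (suc n) = begin
      (q - p) * mass (prefix? {suc n})                             ≡⟨ cong ((q - p) *_) (mass-prefix?-suc n) ⟩
      (q - p) * (q * mass (empty? {n}) + p * mass (prefix? {n}))   ≡⟨ QS.solve 4 (λ p q e r → (q QS.:- p) QS.:* (q QS.:* e QS.:+ p QS.:* r) QS.:= q QS.:* (q QS.:- p) QS.:* e QS.:+ p QS.:* ((q QS.:- p) QS.:* r)) refl p q (mass (empty? {n})) (mass (prefix? {n})) ⟩
      q * (q - p) * mass (empty? {n}) + p * ((q - p) * mass (prefix? {n}))
        ≡⟨ cong₂ (λ e r → q * (q - p) * e + p * r) (mass-empty? n) (mass-prefix? n) ⟩
      q * (q - p) * q ^ n + p * (q ^ suc n - p ^ suc n)            ≡⟨ QS.solve 4 (λ p q Q P → q QS.:* (q QS.:- p) QS.:* Q QS.:+ p QS.:* (q QS.:* Q QS.:- p QS.:* P) QS.:= q QS.:* (q QS.:* Q) QS.:- p QS.:* (p QS.:* P)) refl p q (q ^ n) (p ^ n) ⟩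
      q ^ suc (suc n) - p ^ suc (suc n)                            ∎
      where open ≡-Reasoning

    mass-interval? : ∀ n → (q - p) * (q - p) * mass (interval? {n})
                           ≡ p * (p ^ suc n - (1ℚ + fromℕ n) * (p * q ^ n) + fromℕ n * q ^ suc n)
    mass-interval? zero = QS.solve 2 (λ p q → (q QS.:- p) QS.:* (q QS.:- p) QS.:* QS.con 0ℚ QS.:= p QS.:* (p QS.:* QS.con 1ℚ QS.:- (QS.con 1ℚ QS.:+ QS.con 0ℚ) QS.:* (p QS.:* QS.con 1ℚ) QS.:+ QS.con 0ℚ QS.:* (q QS.:* QS.con 1ℚ))) refl p q
    mass-interval? (suc n) = begin
      (q - p) * (q - p) * mass (interval? {suc n})
        ≡⟨ cong ((q - p) * (q - p) *_) (mass-interval?-suc n) ⟩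
      (q - p) * (q - p) * (q * mass (interval? {n}) + p * mass (prefix? {n}))
        ≡⟨ QS.solve 4 (λ p q i r → (q QS.:- p) QS.:* (q QS.:- p) QS.:* (q QS.:* i QS.:+ p QS.:* r) QS.:= q QS.:* ((q QS.:- p) QS.:* (q QS.:- p) QS.:* i) QS.:+ p QS.:* (q QS.:- p) QS.:* ((q QS.:- p) QS.:* r)) refl p q (mass (interval? {n})) (mass (prefix? {n})) ⟩
      q * ((q - p) * (q - p) * mass (interval? {n})) + p * (q - p) * ((q - p) * mass (prefix? {n}))
        ≡⟨ cong₂ (λ i r → q * i + p * (q - p) * r) (mass-interval? n) (mass-prefix? n) ⟩
      q * (p * (p ^ suc n - (1ℚ + fromℕ n) * (p * q ^ n) + fromℕ n * q ^ suc n)) + p * (q - p) * (q ^ suc n - p ^ suc n)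
        ≡⟨ QS.solve 5 (λ p q P Q N → q QS.:* (p QS.:* (p QS.:* P QS.:- (QS.con 1ℚ QS.:+ N) QS.:* (p QS.:* Q) QS.:+ N QS.:* (q QS.:* Q))) QS.:+ p QS.:* (q QS.:- p) QS.:* (q QS.:* Q QS.:- p QS.:* P)
                      QS.:= p QS.:* (p QS.:* (p QS.:* P) QS.:- (QS.con 1ℚ QS.:+ (QS.con 1ℚ QS.:+ N)) QS.:* (p QS.:* (q QS.:* Q)) QS.:+ (QS.con 1ℚ QS.:+ N) QS.:* (q QS.:* (q QS.:* Q)))) refl p q (p ^ n) (q ^ n) (fromℕ n) ⟩
      p * (p ^ suc (suc n) - (1ℚ + fromℕ (suc n)) * (p * q ^ suc n) + fromℕ (suc n) * q ^ suc (suc n)) ∎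
      where open ≡-Reasoning

  NRel-path : ∀ n p → NRel (path n) p ≡ mass p (interval? {suc n})
  NRel-path n p = trans (NRel≡∑-connected (path n) p)
    (∑-cong (λ S → cong (λ b → indicator b (weight p S)) (connected≡interval? n S)) (allSubsets (suc n)))

module PathSign where

  open import Data.Nat as ℕ using (ℕ; suc; z≤n; s≤s)
  open import Data.Rational using (0ℚ; 1ℚ; _+_; _*_; _-_; -_; _≤_; _<_; positive; nonNegative; +-*-rawSemiring)
  open import Data.Rational.Properties
  open import Algebra.Definitions.RawSemiring +-*-rawSemiring using (_^_)
  open import Relation.Binary.PropositionalEquality
  open RationalFacts
  open Path using (path)
  open PathReliability

  -- For p = m + 1 and an even number N of nodes, (2m + 1)² NRel(P_N; p) = p (P₊ − P₋).
  P₊ P₋ : ℕ → ℕ → ℕ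
  P₊ m N = suc m ℕ.^ suc N
  P₋ m N = suc N ℕ.* (suc m ℕ.* m ℕ.^ N) ℕ.+ N ℕ.* m ℕ.^ suc N

  module _ (m n : ℕ) (even : (- fromℕ m) ^ suc n ≡ fromℕ m ^ suc n) where

    private
      N = suc n
      p = fromℕ (suc m)

    q≡-m : q p ≡ - fromℕ m
    q≡-m = QS.solve 1 (λ x → QS.con 1ℚ QS.:- (QS.con 1ℚ QS.:+ x) QS.:= QS.:- x) refl (fromℕ m)

    fromℕ-P₋ : fromℕ (P₋ m N) ≡ (1ℚ + fromℕ N) * (p * fromℕ (m ℕ.^ N)) + fromℕ N * (fromℕ m * fromℕ (m ℕ.^ N))
    fromℕ-P₋ = trans (fromℕ-+ (suc N ℕ.* (suc m ℕ.* m ℕ.^ N)) (N ℕ.* m ℕ.^ suc N))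
      (cong₂ _+_ (trans (fromℕ-* (suc N) (suc m ℕ.* m ℕ.^ N)) (cong ((1ℚ + fromℕ N) *_) (fromℕ-* (suc m) (m ℕ.^ N))))
                 (trans (fromℕ-* N (m ℕ.^ suc N)) (cong (fromℕ N *_) (fromℕ-* m (m ℕ.^ N)))))

    closed-form : p * (p ^ suc N - (1ℚ + fromℕ N) * (p * q p ^ N) + fromℕ N * q p ^ suc N)
                  ≡ p * (fromℕ (P₊ m N) - fromℕ (P₋ m N))
    closed-form = begin
      p * (p ^ suc N - (1ℚ + fromℕ N) * (p * q p ^ N) + fromℕ N * (q p * q p ^ N))
        ≡⟨ cong₂ (λ x y → p * (x - (1ℚ + fromℕ N) * (p * y) + fromℕ N * (q p * y))) (sym (fromℕ-^ (suc m) (suc N))) q^N ⟩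
      p * (fromℕ (P₊ m N) - (1ℚ + fromℕ N) * (p * fromℕ (m ℕ.^ N)) + fromℕ N * (q p * fromℕ (m ℕ.^ N)))
        ≡⟨ cong (λ x → p * (fromℕ (P₊ m N) - (1ℚ + fromℕ N) * (p * fromℕ (m ℕ.^ N)) + fromℕ N * (x * fromℕ (m ℕ.^ N)))) q≡-m ⟩
      p * (fromℕ (P₊ m N) - (1ℚ + fromℕ N) * (p * fromℕ (m ℕ.^ N)) + fromℕ N * (- fromℕ m * fromℕ (m ℕ.^ N)))
        ≡⟨ QS.solve 5 (λ p X n M x → p QS.:* (X QS.:- (QS.con 1ℚ QS.:+ n) QS.:* (p QS.:* M) QS.:+ n QS.:* ((QS.:- x) QS.:* M))
                         QS.:= p QS.:* (X QS.:- ((QS.con 1ℚ QS.:+ n) QS.:* (p QS.:* M) QS.:+ n QS.:* (x QS.:* M)))) refl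
                       p (fromℕ (P₊ m N)) (fromℕ N) (fromℕ (m ℕ.^ N)) (fromℕ m) ⟩
      p * (fromℕ (P₊ m N) - ((1ℚ + fromℕ N) * (p * fromℕ (m ℕ.^ N)) + fromℕ N * (fromℕ m * fromℕ (m ℕ.^ N))))
        ≡⟨ cong (λ y → p * (fromℕ (P₊ m N) - y)) fromℕ-P₋ ⟨
      p * (fromℕ (P₊ m N) - fromℕ (P₋ m N)) ∎
      where
      open ≡-Reasoning
      q^N : q p ^ N ≡ fromℕ (m ℕ.^ N)
      q^N = trans (cong (_^ N) q≡-m) (trans even (sym (fromℕ-^ m N)))

    0<[q-p]² : 0ℚ < (q p - p) * (q p - p)
    0<[q-p]² = subst (0ℚ <_) (sym [q-p]²) (fromℕ-mono-< {0} {suc (m ℕ.+ m) ℕ.* suc (m ℕ.+ m)} (s≤s z≤n))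
      where
      [q-p]² : (q p - p) * (q p - p) ≡ fromℕ (suc (m ℕ.+ m) ℕ.* suc (m ℕ.+ m))
      [q-p]² = begin
        (q p - p) * (q p - p)           ≡⟨ cong (λ x → (x - p) * (x - p)) q≡-m ⟩
        (- fromℕ m - p) * (- fromℕ m - p) ≡⟨ QS.solve 1 (λ x → ((QS.:- x) QS.:- (QS.con 1ℚ QS.:+ x)) QS.:* ((QS.:- x) QS.:- (QS.con 1ℚ QS.:+ x)) QS.:= (QS.con 1ℚ QS.:+ (x QS.:+ x)) QS.:* (QS.con 1ℚ QS.:+ (x QS.:+ x))) refl (fromℕ m) ⟩
        (1ℚ + (fromℕ m + fromℕ m)) * (1ℚ + (fromℕ m + fromℕ m)) ≡⟨ cong (λ x → (1ℚ + x) * (1ℚ + x)) (fromℕ-+ m m) ⟨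
        fromℕ (suc (m ℕ.+ m)) * fromℕ (suc (m ℕ.+ m)) ≡⟨ fromℕ-* (suc (m ℕ.+ m)) (suc (m ℕ.+ m)) ⟨
        fromℕ (suc (m ℕ.+ m) ℕ.* suc (m ℕ.+ m)) ∎
        where open ≡-Reasoning

    scaled-NRel : (q p - p) * (q p - p) * NRel (path n) p ≡ p * (fromℕ (P₊ m N) - fromℕ (P₋ m N))
    scaled-NRel = trans (cong ((q p - p) * (q p - p) *_) (NRel-path n p)) (trans (mass-interval? p N) closed-form)

    NRel-nonneg : P₋ m N ℕ.≤ P₊ m N → 0ℚ ≤ NRel (path n) p
    NRel-nonneg P₋≤P₊ = *-cancelˡ-≤-pos ((q p - p) * (q p - p)) {{positive 0<[q-p]²}}
      (subst₂ _≤_ (sym (*-zeroʳ ((q p - p) * (q p - p)))) (sym scaled-NRel) (0≤* (0≤fromℕ (suc m)) (p≤q⇒0≤q-p (fromℕ-mono-≤ P₋≤P₊))))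

    NRel-nonpos : P₊ m N ℕ.≤ P₋ m N → NRel (path n) p ≤ 0ℚ
    NRel-nonpos P₊≤P₋ = *-cancelˡ-≤-pos ((q p - p) * (q p - p)) {{positive 0<[q-p]²}}
      (subst₂ _≤_ (sym scaled-NRel) (sym (*-zeroʳ ((q p - p) * (q p - p))))
        (subst (p * (fromℕ (P₊ m N) - fromℕ (P₋ m N)) ≤_) (*-zeroʳ p)
          (*-monoˡ-≤-nonNeg p {{nonNegative (0≤fromℕ (suc m))}}
            (subst (fromℕ (P₊ m N) - fromℕ (P₋ m N) ≤_) (+-inverseʳ (fromℕ (P₋ m N)))
              (+-monoˡ-≤ (- fromℕ (P₋ m N)) (fromℕ-mono-≤ P₊≤P₋))))))

module Estimates where

  open import Data.Nat
  open import Data.Nat.Properties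
  open import Data.Nat.Solver using (module +-*-Solver)
  open import Relation.Binary.PropositionalEquality
  open import Relation.Nullary.Decidable using (toWitness)
  open import Data.Product using (_,_)
  open import Data.Unit using (tt)
  open +-*-Solver
  open PathSign using (P₊; P₋)

  -- (1 + 1/m)ᵏ ≥ 1 + k/m, cleared of denominators.
  bernoulli : ∀ m k → m ^ k * (m + k) ≤ m * suc m ^ k
  bernoulli m zero = ≤-reflexive (solve 1 (λ m → con 1 :* (m :+ con 0) := m :* con 1) refl m)
  bernoulli m (suc k) = begin
    m ^ suc k * (m + suc k)                 ≤⟨ m≤m+n _ (m ^ k * k) ⟩
    m ^ suc k * (m + suc k) + m ^ k * k     ≡⟨ solve 3 (λ m P k → m :* P :* (m :+ (con 1 :+ k)) :+ P :* k := (con 1 :+ m) :* (P :* (m :+ k))) refl m (m ^ k) k ⟩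
    suc m * (m ^ k * (m + k))               ≤⟨ *-monoʳ-≤ (suc m) (bernoulli m k) ⟩
    suc m * (m * suc m ^ k)                 ≡⟨ solve 2 (λ m Q → (con 1 :+ m) :* (m :* Q) := m :* ((con 1 :+ m) :* Q)) refl m (suc m ^ k) ⟩
    m * suc m ^ suc k                       ∎
    where open ≤-Reasoning

  -- (1 + 1/M)ᵏ ≤ 1 + 2k/M as long as 2k ≤ M, cleared of denominators.
  bernoulli-upper : ∀ M k → 2 * k ≤ M → M * suc M ^ k ≤ M ^ k * (M + 2 * k)
  bernoulli-upper M zero _ = ≤-reflexive (solve 1 (λ M → M :* con 1 := con 1 :* (M :+ con 0)) refl M)
  bernoulli-upper M (suc k) 2k+2≤M with m≤n⇒∃[o]m+o≡n 2k+2≤M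
  ... | d , refl = begin
    M * suc M ^ suc k                       ≡⟨ solve 2 (λ M Q → M :* ((con 1 :+ M) :* Q) := (con 1 :+ M) :* (M :* Q)) refl M (suc M ^ k) ⟩
    suc M * (M * suc M ^ k)                 ≤⟨ *-monoʳ-≤ (suc M) (bernoulli-upper M k (≤-trans (*-monoʳ-≤ 2 (n≤1+n k)) 2k+2≤M)) ⟩
    suc M * (M ^ k * (M + 2 * k))           ≤⟨ m≤m+n _ (M ^ k * (d + 2)) ⟩
    suc M * (M ^ k * (M + 2 * k)) + M ^ k * (d + 2)
      ≡⟨ solve 3 (λ k d P → (con 1 :+ (con 2 :* (con 1 :+ k) :+ d)) :* (P :* ((con 2 :* (con 1 :+ k) :+ d) :+ con 2 :* k)) :+ P :* (d :+ con 2)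
            := (con 2 :* (con 1 :+ k) :+ d) :* P :* ((con 2 :* (con 1 :+ k) :+ d) :+ con 2 :* (con 1 :+ k))) refl k d (M ^ k) ⟩
    M ^ suc k * (M + 2 * suc k)             ∎
    where open ≤-Reasoning

  ^-distribʳ-* : ∀ a b c → (a * b) ^ c ≡ a ^ c * b ^ c
  ^-distribʳ-* a b zero = refl
  ^-distribʳ-* a b (suc c) = trans (cong (a * b *_) (^-distribʳ-* a b c))
    (solve 4 (λ a b x y → a :* b :* (x :* y) := a :* x :* (b :* y)) refl a b (a ^ c) (b ^ c))

  2a^a≤[1+a]^a : ∀ a → 2 * suc a ^ suc a ≤ suc (suc a) ^ suc a
  2a^a≤[1+a]^a m = *-cancelˡ-≤ (suc m) (begin
    suc m * (2 * suc m ^ suc m)             ≡⟨ solve 2 (λ a P → a :* (con 2 :* P) := P :* (a :+ a)) refl (suc m) (suc m ^ suc m) ⟩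
    suc m ^ suc m * (suc m + suc m)         ≤⟨ bernoulli (suc m) (suc m) ⟩
    suc m * suc (suc m) ^ suc m             ∎)
    where open ≤-Reasoning

  2^a*a^[a*a]≤[1+a]^[a*a] : ∀ m → 2 ^ suc m * suc m ^ (suc m * suc m) ≤ suc (suc m) ^ (suc m * suc m)
  2^a*a^[a*a]≤[1+a]^[a*a] m = begin
    2 ^ a * a ^ (a * a)                     ≡⟨ cong (2 ^ a *_) (^-*-assoc a a a) ⟨
    2 ^ a * (a ^ a) ^ a                     ≡⟨ ^-distribʳ-* 2 (a ^ a) a ⟨
    (2 * a ^ a) ^ a                         ≤⟨ ^-monoˡ-≤ a (2a^a≤[1+a]^a m) ⟩
    (suc a ^ a) ^ a                         ≡⟨ ^-*-assoc (suc a) a a ⟩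
    suc a ^ (a * a)                         ∎
    where
    open ≤-Reasoning
    a = suc m

  a[2a+1]≤2^a : ∀ t → (7 + t) * (2 * (7 + t) + 1) ≤ 2 ^ (7 + t)
  a[2a+1]≤2^a zero = toWitness {a? = 105 ≤? 128} tt
  a[2a+1]≤2^a (suc t) = begin
    (8 + t) * (2 * (8 + t) + 1)             ≤⟨ m≤m+n _ (74 + 25 * t + 2 * (t * t)) ⟩
    (8 + t) * (2 * (8 + t) + 1) + (74 + 25 * t + 2 * (t * t))
      ≡⟨ solve 1 (λ t → (con 8 :+ t) :* (con 2 :* (con 8 :+ t) :+ con 1) :+ (con 74 :+ con 25 :* t :+ con 2 :* (t :* t))
           := con 2 :* ((con 7 :+ t) :* (con 2 :* (con 7 :+ t) :+ con 1))) refl t ⟩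
    2 * ((7 + t) * (2 * (7 + t) + 1))       ≤⟨ *-monoʳ-≤ 2 (a[2a+1]≤2^a t) ⟩
    2 * 2 ^ (7 + t)                         ∎
    where open ≤-Reasoning

  P₋≤P₊ : ∀ t N → suc N ≡ (7 + t) * (7 + t) → P₋ (7 + t) N ≤ P₊ (7 + t) N
  P₋≤P₊ t N N+1≡m² = begin
    suc N * (suc m * m ^ N) + N * (m * m ^ N)       ≤⟨ +-monoʳ-≤ (suc N * (suc m * m ^ N)) (*-monoˡ-≤ (m * m ^ N) (n≤1+n N)) ⟩
    suc N * (suc m * m ^ N) + suc N * (m * m ^ N)   ≡⟨ solve 3 (λ n m P → n :* ((con 1 :+ m) :* P) :+ n :* (m :* P) := n :* ((con 1 :+ m :+ m) :* P)) refl (suc N) m (m ^ N) ⟩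
    suc N * ((suc m + m) * m ^ N)                   ≡⟨ cong (λ z → z * ((suc m + m) * m ^ N)) N+1≡m² ⟩
    m * m * ((suc m + m) * m ^ N)                   ≡⟨ solve 2 (λ m P → m :* m :* ((con 1 :+ m :+ m) :* P) := m :* (con 2 :* m :+ con 1) :* (m :* P)) refl m (m ^ N) ⟩
    m * (2 * m + 1) * (m * m ^ N)                   ≤⟨ *-monoˡ-≤ (m * m ^ N) (a[2a+1]≤2^a t) ⟩
    2 ^ m * m ^ suc N                               ≡⟨ cong (λ z → 2 ^ m * m ^ z) N+1≡m² ⟩
    2 ^ m * m ^ (m * m)                             ≤⟨ 2^a*a^[a*a]≤[1+a]^[a*a] (6 + t) ⟩
    suc m ^ (m * m)                                 ≡⟨ cong (suc m ^_) N+1≡m² ⟨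
    suc m * suc m ^ N                               ∎
    where
    open ≤-Reasoning
    m = 7 + t

  P₊≤P₋ : ∀ N → 1 ≤ N → P₊ (2 * suc N) N ≤ P₋ (2 * suc N) N
  P₊≤P₋ N 1≤N = begin
    suc M ^ suc N                                   ≤⟨ *-cancelˡ-≤ M (begin
        M * suc M ^ suc N                               ≤⟨ bernoulli-upper M (suc N) ≤-refl ⟩
        M ^ suc N * (M + M)                             ≡⟨ solve 2 (λ M P → P :* (M :+ M) := M :* (con 2 :* P)) refl M (M ^ suc N) ⟩
        M * (2 * M ^ suc N)                             ∎) ⟩
    2 * (M * M ^ N)                                 ≤⟨ *-monoˡ-≤ (M * M ^ N) (s≤s 1≤N) ⟩
    suc N * (M * M ^ N)                             ≤⟨ *-monoʳ-≤ (suc N) (*-monoˡ-≤ (M ^ N) (n≤1+n M)) ⟩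
    suc N * (suc M * M ^ N)                         ≤⟨ m≤m+n _ _ ⟩
    suc N * (suc M * M ^ N) + N * (M * M ^ N)       ∎
    where
    open ≤-Reasoning
    M = 2 * suc N

module Roots where

  import Data.Nat as ℕ
  open import Data.Rational using (0ℚ; _+_; _≤_)
  open import Data.Rational.Properties using (≤-reflexive)
  open import Data.Product using (_,_)
  open import Relation.Binary.PropositionalEquality
  open RationalFacts using (fromℕ; fromℕ-+; 0≤fromℕ)
  open Lipschitz using (module OnInterval)
  open IntermediateValue using (module Bisection)

  NRel-root-between : ∀ G a W → 0ℚ ≤ NRel G (fromℕ a) → NRel G (fromℕ (a ℕ.+ W)) ≤ 0ℚ →
    ∃[ r ] (IsNodeReliabilityRoot G r × ∀ k → fromℕ a ≤ ℝ.seq r k)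
  NRel-root-between G a W 0≤f[a] f[a+W]≤0 =
    root , f[root]≈0 , lo≤root
    where
    a+W≡ : fromℕ a + fromℕ W ≡ fromℕ (a ℕ.+ W)
    a+W≡ = sym (fromℕ-+ a W)
    open OnInterval (fromℕ a) (fromℕ a + fromℕ W) (a ℕ.+ W) (0≤fromℕ a) (≤-reflexive a+W≡)
    open BoundedLipschitz (NRel-BL G)
    open Bisection (NRel G) (fromℕ a) W constant lipschitz 0≤f[a] (subst (λ x → NRel G x ≤ 0ℚ) (sym a+W≡) f[a+W]≤0)

module LargeRoots where

  open import Data.Nat as ℕ using (ℕ; suc; pred; _∸_; z≤n; s≤s)
  import Data.Nat.Properties as ℕ
  open import Data.Nat.Solver using (module +-*-Solver)
  open import Data.Integer using (+_)
  open import Data.Rational using (0ℚ; 1ℚ; _+_; _/_; _≤_; _<_)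
  open import Data.Rational.Properties using (+-comm; ≤-trans; <-≤-trans; 0≤p⇒∣p∣≡p)
  open import Data.Product using (_,_)
  open import Relation.Binary.PropositionalEquality
  open RationalFacts using (fromℕ; fromℕ≡/1; fromℕ-mono-<; 0≤fromℕ; ^-even)
  open Path using (path)
  open PathSign using (NRel-nonneg; NRel-nonpos)
  open Estimates using (P₋≤P₊; P₊≤P₋)
  open Roots using (NRel-root-between)

  -- m = 7 + 2B is odd, so the path on N = m² − 1 nodes has an even number of nodes;
  -- its reliability polynomial changes sign between m + 1 and 2(N + 1) + 1.
  large-root : ∀ B → ∃[ G ] ∃[ r ] (IsNodeReliabilityRoot G r × ∀ k → fromℕ (8 ℕ.+ 2 ℕ.* B) ≤ ℝ.seq r k)
  large-root B = path n , NRel-root-between (path n) (suc m) (M ∸ m) nonneg nonpos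
    where
    m K n N M : ℕ
    m = 7 ℕ.+ 2 ℕ.* B
    K = 2 ℕ.* ((3 ℕ.+ B) ℕ.* (4 ℕ.+ B))
    n = pred (2 ℕ.* K)
    N = suc n
    M = 2 ℕ.* suc N

    N+1≡m² : suc N ≡ m ℕ.* m
    N+1≡m² = solve 1 (λ b → con 1 :+ con 2 :* (con 2 :* ((con 3 :+ b) :* (con 4 :+ b))) := (con 7 :+ con 2 :* b) :* (con 7 :+ con 2 :* b)) refl B
      where open +-*-Solver

    m≤M : m ℕ.≤ M
    m≤M = ℕ.≤-trans (ℕ.m≤m*n m m) (subst (ℕ._≤ M) N+1≡m² (ℕ.m≤n*m (suc N) 2))

    nonneg : 0ℚ ≤ NRel (path n) (fromℕ (suc m))
    nonneg = NRel-nonneg m n (^-even (fromℕ m) K refl) (P₋≤P₊ (2 ℕ.* B) N N+1≡m²)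

    nonpos : NRel (path n) (fromℕ (suc m ℕ.+ (M ∸ m))) ≤ 0ℚ
    nonpos = subst (λ x → NRel (path n) (fromℕ (suc x)) ≤ 0ℚ) (sym (ℕ.m+[n∸m]≡n m≤M))
      (NRel-nonpos M n (^-even (fromℕ M) K refl) (P₊≤P₋ N (s≤s z≤n)))

  lower-bound⇒<∣∣ : ∀ B r → fromℕ (2 ℕ.+ B) ≤ ℝ.seq r 0 → B <∣ r ∣
  lower-bound⇒<∣∣ B r 2+B≤r₀ = 0 , subst₂ _<_ B+1≡ (sym (0≤p⇒∣p∣≡p (≤-trans (0≤fromℕ (2 ℕ.+ B)) 2+B≤r₀)))
    (<-≤-trans (fromℕ-mono-< (ℕ.n<1+n (1 ℕ.+ B))) 2+B≤r₀)
    where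
    B+1≡ : fromℕ (1 ℕ.+ B) ≡ (+ B / 1) + (+ 1 / 1)
    B+1≡ = trans (+-comm 1ℚ (fromℕ B)) (cong (_+ 1ℚ) (fromℕ≡/1 B))

open import Data.Product using (_,_)
open import Data.Nat as ℕ using (_+_; _*_; _≤_; s≤s)
import Data.Nat.Properties as ℕ
open import Data.Rational.Properties using (≤-trans)
open RationalFacts using (fromℕ-mono-≤)
open LargeRoots using (large-root; lower-bound⇒<∣∣)

theorem4 : ∀ (B : ℕ) → ∃[ G ] ∃[ r ] (IsNodeReliabilityRoot G r × B <∣ r ∣)
theorem4 B =
  -- The indices of fromℕ-mono-≤ are given explicitly: inferring them would unfold rational arithmetic.
  let (G , r , isRoot , above) = large-root B
  in  G , r , isRoot , lower-bound⇒<∣∣ B r (≤-trans (fromℕ-mono-≤ {2 + B} {8 + 2 * B} 2+B≤8+2B) (above 0))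
  where
  2+B≤8+2B : 2 + B ≤ 8 + 2 * B
  2+B≤8+2B = s≤s (s≤s (ℕ.≤-trans (ℕ.m≤m+n B (B + 0)) (ℕ.m≤n+m (2 * B) 6)))
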